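{- Let $(x_n)_{n\ge1}$ be a sequence in $\mathbb{N}$ and $(\alpha_n)_{n\ge1}$ a sequence of positive reals such that $\alpha_n>\alpha_0$ for all $n$, for some fixed $\alpha_0>0$. Suppose $F_n=(x_n,x_n(1+\alpha_n)]$ defines a Følner sequence $(F_n)$ in $\mathbb{N}$. Then $\overline d_{F_n}(V)=0$.
   Context: $\phi$ is Euler's totient function and $V=\phi(\mathbb{N})$. For reals $a<b$, $(a,b]$ denotes $\{x\in\mathbb{N}\colon a<x\le b\}$. A Følner sequence in $(\mathbb{N},+)$ is a sequence $(F_n)$ of finite subsets of $\mathbb{N}$ with $\lim_{n\to\infty}|(g+F_n)\cap F_n|/|F_n|=1$ for all $g\in\mathbb{N}$. For $A\subset\mathbb{N}$, $\overline d_{F_n}(A)=\limsup_{n\to\infty}|F_n\cap A|/|F_n|$.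
   Formalization: The sequence $(\alpha_n)$ and the bound $\alpha_0$ take rational values instead of real ones. -}

module Defs where

open import Data.Nat as ℕ using (ℕ; zero; suc; _∸_; _≟_)
open import Data.Nat.GCD using (gcd)
open import Data.Integer as ℤ using (+_)
open import Data.Rational using (ℚ; _/_; _+_; _*_; _-_; _<_; _≤_; ∣_∣; 0ℚ; 1ℚ; floor)
open import Data.List using (List; map; filter; length; upTo)
open import Data.List.Membership.Propositional using (_∈_)
open import Data.List.Membership.DecPropositional _≟_ using (_∈?_)
open import Data.List.Relation.Unary.All using (All)
open import Data.List.Relation.Unary.Unique.Propositional using (Unique)
open import Data.Product using (∃; _×_)
open import Relation.Binary.PropositionalEquality using (_≡_)

ι : ℕ → ℚ
ι n = + n / 1

-- the integer interval (a , b] = { x ∈ ℕ : a < x ≤ b }, listed without repetition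
Ioc : ℕ → ℕ → List ℕ
Ioc a b = map (λ i → suc (a ℕ.+ i)) (upTo (b ∸ a))

shift : ℕ → List ℕ → List ℕ
shift g F = map (g ℕ.+_) F

_∩_ : List ℕ → List ℕ → List ℕ
A ∩ B = filter (_∈? B) A

φ : ℕ → ℕ
φ n = length (filter (λ k → gcd k n ≟ 1) (Ioc 0 n))

-- V = φ(ℕ), ℕ = {1,2,...}
V : ℕ → Set
V v = ∃ λ m → φ (suc m) ≡ v

-- F_n = (x_n , x_n (1 + α_n)]   (upper endpoint = floor of x_n(1+α_n), which is ≥ 0)
Fseq : (ℕ → ℕ) → (ℕ → ℚ) → ℕ → List ℕ
Fseq x α n = Ioc (x n) (ℤ.∣ floor (ι (x n) * (1ℚ + α n)) ∣)

-- (F_n) is Følner: for every g, |(g+F_n) ∩ F_n| / |F_n| → 1,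
-- written without division as | |(g+F_n)∩F_n| - |F_n| | < ε |F_n| eventually
Folner : (ℕ → List ℕ) → Set
Folner F = ∀ (g : ℕ) (ε : ℚ) → 0ℚ < ε → ∃ λ N → ∀ n → N ℕ.≤ n →
  ∣ ι (length (shift g (F n) ∩ F n)) - ι (length (F n)) ∣ < ε * ι (length (F n))

-- upper density of A along (F_n) is 0:  limsup |F_n ∩ A| / |F_n| = 0, i.e.
-- for every ε > 0, eventually |F_n ∩ A| ≤ ε |F_n|; since A need not be decidable,
-- "|F_n ∩ A| ≤ k" is expressed as: every repetition-free list of elements of F_n ∩ A has length ≤ k
UpperDensityZero : (ℕ → List ℕ) → (ℕ → Set) → Set
UpperDensityZero F A = ∀ (ε : ℚ) → 0ℚ < ε → ∃ λ N → ∀ n → N ℕ.≤ n →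
  ∀ (L : List ℕ) → Unique L → All (λ v → v ∈ F n × A v) L →
  ι (length L) ≤ ε * ι (length (F n))

-- A totient value v = φ n ≤ Y is either divisible by 2^k, or n has fewer than k distinct odd prime
-- factors (each contributes a factor 2 to φ n), and then n ≤ 2^k v.  Fix k pairwise coprime odd
-- blocks P, each a product of consecutive primes with φ P / P tiny; this is possible because
-- ∏ p / (p - 1) diverges, which follows from the harmonic series by expanding over smooth numbers.
-- An n with few odd prime factors is coprime to some block, and few n ≤ 2^k Y are, so the totient
-- values have density zero.  For the Følner intervals F = (x, x (1 + α)], shifting by 1 shows that
-- |F| → ∞, and α > α₀ gives x = O(|F|); so F ⊆ (0, C |F|] and the density zero transfers to F.
module Submission where

open import Data.Nat
open import Data.Nat.Properties
open import Algebra.Properties.CommutativeSemigroup +-commutativeSemigroup using () renaming (interchange to +-interchange)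
open import Data.Nat.Coprimality using (Coprime; coprime?; coprime-divisor; coprime-+; gcd≡1⇒coprime; coprime⇒gcd≡1)
import Data.Nat.Coprimality as Coprime
open import Data.Nat.Divisibility
open import Data.Nat.DivMod
open import Data.Nat.GCD using (gcd)
open import Data.Nat.Induction using (<-wellFounded)
open import Data.Nat.ListAction using (product)
open import Data.Nat.ListAction.Properties using (product-++)
open import Data.Nat.Primality using (Prime; prime?; prime[2]; prime⇒irreducible; prime⇒nonTrivial; euclidsLemma; productOfPrimes≢0; productOfPrimes≥1)
open import Data.Nat.Primality.Factorisation using (factorise; PrimeFactorisation)
open import Data.Nat.Tactic.RingSolver using (solve-∀)
open import Data.List using (List; []; _∷_; _++_; length; map; filter; upTo; applyUpTo)
open import Data.List.Properties using (length-map; length-upTo; length-++; map-applyUpTo; map-++; filter-notAll)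
open import Data.List.Membership.Propositional using (_∈_)
open import Data.List.Membership.Propositional.Properties using (∈-filter⁺; ∈-filter⁻; ∈-map⁺; ∈-map⁻; ∈-upTo⁺; ∈-upTo⁻; ∈-++⁺ˡ; ∈-++⁺ʳ)
open import Data.List.Membership.DecPropositional _≟_ using (_∈?_)
open import Data.List.Relation.Binary.Subset.Propositional using (_⊆_)
open import Data.List.Relation.Unary.All as All using (All; []; _∷_)
open import Data.List.Relation.Unary.AllPairs using (AllPairs; []; _∷_)
open import Data.List.Relation.Unary.Any as Any using (Any; here; there; any?)
open import Data.List.Relation.Unary.Unique.Propositional using (Unique)
import Data.List.Relation.Unary.Unique.Propositional.Properties as Unique
open import Data.Integer as ℤ using (+≤+; +<+)
import Data.Integer.Properties as ℤ
open import Data.Rational as ℚ using (ℚ; mkℚ; 0ℚ; 1ℚ; floor; *≤*; *<*; Positive; NonNegative)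
import Data.Rational.Properties as ℚ
import Data.Rational.Unnormalised as ℚᵘ
import Data.Rational.Unnormalised.Properties as ℚᵘ
open import Data.Product using (_×_; _,_; proj₁; proj₂; ∃; ∃₂)
import Data.Product as Product
open import Data.Sum using (_⊎_; inj₁; inj₂)
open import Function using (_∘_; _⇔_; Equivalence; mk⇔)
open import Induction.WellFounded using (Acc; acc)
open import Relation.Binary using (DecidableEquality)
open import Relation.Binary.PropositionalEquality
open import Relation.Nullary using (Dec; yes; no; ¬_; ¬?; _×-dec_; _→-dec_; contradiction)
import Relation.Nullary.Decidable as Dec

open import Defs

-- Finite sums and Iverson brackets

∑< : ℕ → (ℕ → ℕ) → ℕ
∑< zero    f = 0
∑< (suc n) f = f 0 + ∑< n (f ∘ suc)

syntax ∑< n (λ i → e) = ∑[ i < n ] e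

𝟙 : {P : Set} → Dec P → ℕ
𝟙 (yes _) = 1
𝟙 (no _)  = 0

𝟙-cong : {P Q : Set} → P ⇔ Q → (p : Dec P) (q : Dec Q) → 𝟙 p ≡ 𝟙 q
𝟙-cong _   (yes _) (yes _) = refl
𝟙-cong _   (no _)  (no _)  = refl
𝟙-cong P⇔Q (yes p) (no ¬q) = contradiction (Equivalence.to P⇔Q p) ¬q
𝟙-cong P⇔Q (no ¬p) (yes q) = contradiction (Equivalence.from P⇔Q q) ¬p

𝟙-*-×-dec : {P Q : Set} (p : Dec P) (q : Dec Q) → 𝟙 p * 𝟙 q ≡ 𝟙 (p ×-dec q)
𝟙-*-×-dec (yes _) (yes _) = refl
𝟙-*-×-dec (yes _) (no _)  = refl
𝟙-*-×-dec (no _)  _       = refl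

𝟙-split : {P : Set} (p : Dec P) (x : ℕ) → x ≡ 𝟙 p * x + 𝟙 (¬? p) * x
𝟙-split (yes _) x = sym (trans (+-identityʳ (x + 0)) (+-identityʳ x))
𝟙-split (no _)  x = sym (+-identityʳ x)

𝟙-yes : {P : Set} (p : Dec P) → P → 𝟙 p ≡ 1
𝟙-yes (yes _) _  = refl
𝟙-yes (no ¬p) p = contradiction p ¬p

𝟙-no : {P : Set} (p : Dec P) → ¬ P → 𝟙 p ≡ 0
𝟙-no (yes p) ¬p = contradiction p ¬p
𝟙-no (no _)  _  = refl

𝟙≤1 : {P : Set} (p : Dec P) → 𝟙 p ≤ 1
𝟙≤1 (yes _) = ≤-refl
𝟙≤1 (no _)  = z≤n

𝟙-mono : {P Q : Set} (p : Dec P) (q : Dec Q) → (P → Q) → 𝟙 p ≤ 𝟙 q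
𝟙-mono (yes p) q P→Q = ≤-reflexive (sym (𝟙-yes q (P→Q p)))
𝟙-mono (no _)  q _   = z≤n

𝟙*≤ : {P : Set} (p : Dec P) (x : ℕ) → 𝟙 p * x ≤ x
𝟙*≤ (yes _) x = ≤-reflexive (+-identityʳ x)
𝟙*≤ (no _)  x = z≤n

∑-cong : ∀ n {f g : ℕ → ℕ} → (∀ {i} → i < n → f i ≡ g i) → ∑[ i < n ] f i ≡ ∑[ i < n ] g i
∑-cong zero    _  = refl
∑-cong (suc n) eq = cong₂ _+_ (eq z<s) (∑-cong n (eq ∘ s<s))

∑-mono-≤ : ∀ n {f g : ℕ → ℕ} → (∀ {i} → i < n → f i ≤ g i) → ∑[ i < n ] f i ≤ ∑[ i < n ] g i
∑-mono-≤ zero    _  = z≤n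
∑-mono-≤ (suc n) le = +-mono-≤ (le z<s) (∑-mono-≤ n (le ∘ s<s))

∑-distrib-+ : ∀ n {f g : ℕ → ℕ} → ∑[ i < n ] (f i + g i) ≡ ∑[ i < n ] f i + ∑[ i < n ] g i
∑-distrib-+ zero            = refl
∑-distrib-+ (suc n) {f} {g} = trans (cong (f 0 + g 0 +_) (∑-distrib-+ n)) (+-interchange (f 0) (g 0) _ _)

∑-+ : ∀ m n (f : ℕ → ℕ) → ∑[ i < m + n ] f i ≡ ∑[ i < m ] f i + ∑[ i < n ] f (m + i)
∑-+ zero    n f = refl
∑-+ (suc m) n f = trans (cong (f 0 +_) (∑-+ m n (f ∘ suc))) (sym (+-assoc (f 0) _ _))

∑-last : ∀ n (f : ℕ → ℕ) → ∑[ i < suc n ] f i ≡ ∑[ i < n ] f i + f n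
∑-last n f = begin
  ∑[ i < suc n ] f i                   ≡⟨ cong (λ m → ∑[ i < m ] f i) (+-comm 1 n) ⟩
  ∑[ i < n + 1 ] f i                   ≡⟨ ∑-+ n 1 f ⟩
  ∑[ i < n ] f i + (f (n + 0) + 0)     ≡⟨ cong (λ x → ∑[ i < n ] f i + x) (trans (+-identityʳ _) (cong f (+-identityʳ n))) ⟩
  ∑[ i < n ] f i + f n                 ∎
  where open ≡-Reasoning

∑-mono-bound : ∀ {m n} (f : ℕ → ℕ) → m ≤ n → ∑[ i < m ] f i ≤ ∑[ i < n ] f i
∑-mono-bound {m} {n} f m≤n = begin
  ∑[ i < m ] f i                                      ≤⟨ m≤m+n _ _ ⟩
  ∑[ i < m ] f i + ∑[ i < n ∸ m ] f (m + i)            ≡⟨ ∑-+ m (n ∸ m) f ⟨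
  ∑[ i < m + (n ∸ m) ] f i                            ≡⟨ cong (λ k → ∑[ i < k ] f i) (m+[n∸m]≡n m≤n) ⟩
  ∑[ i < n ] f i                                      ∎
  where open ≤-Reasoning

∑-*-distribˡ : ∀ n c (f : ℕ → ℕ) → ∑[ i < n ] (c * f i) ≡ c * ∑[ i < n ] f i
∑-*-distribˡ zero    c f = sym (*-zeroʳ c)
∑-*-distribˡ (suc n) c f = trans (cong (c * f 0 +_) (∑-*-distribˡ n c (f ∘ suc))) (sym (*-distribˡ-+ c (f 0) _))

∑-const : ∀ n c → ∑[ i < n ] c ≡ n * c
∑-const zero    c = refl
∑-const (suc n) c = cong (c +_) (∑-const n c)

∑-zero : ∀ n {f : ℕ → ℕ} → (∀ {i} → i < n → f i ≡ 0) → ∑[ i < n ] f i ≡ 0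
∑-zero n f≡0 = trans (∑-cong n f≡0) (trans (∑-const n 0) (*-zeroʳ n))

∑-periodic : ∀ t m (f : ℕ → ℕ) → (∀ i → f (m + i) ≡ f i) → ∑[ i < t * m ] f i ≡ t * ∑[ i < m ] f i
∑-periodic zero    m f per = refl
∑-periodic (suc t) m f per = begin
  ∑[ i < m + t * m ] f i                          ≡⟨ ∑-+ m (t * m) f ⟩
  ∑[ i < m ] f i + ∑[ i < t * m ] f (m + i)        ≡⟨ cong (∑[ i < m ] f i +_) (∑-cong (t * m) (λ {i} _ → per i)) ⟩
  ∑[ i < m ] f i + ∑[ i < t * m ] f i              ≡⟨ cong (∑[ i < m ] f i +_) (∑-periodic t m f per) ⟩
  ∑[ i < m ] f i + t * ∑[ i < m ] f i              ∎
  where open ≡-Reasoning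

∑-split : ∀ n {Q : ℕ → Set} (Q? : ∀ i → Dec (Q i)) (f : ℕ → ℕ) →
  ∑[ i < n ] f i ≡ ∑[ i < n ] (𝟙 (Q? i) * f i) + ∑[ i < n ] (𝟙 (¬? (Q? i)) * f i)
∑-split n Q? f = trans (∑-cong n (λ {i} _ → 𝟙-split (Q? i) (f i))) (∑-distrib-+ n)

∣-+-self : ∀ {d n} → d ∣ d + n ⇔ d ∣ n
∣-+-self = mk⇔ (λ d∣d+n → ∣m+n∣m⇒∣n d∣d+n ∣-refl) (∣m∣n⇒∣m+n ∣-refl)

∑-multiples : ∀ t p .{{_ : NonZero p}} (h : ℕ → ℕ) →
  ∑[ i < t * p ] (𝟙 (p ∣? suc i) * h (suc i)) ≡ ∑[ j < t ] h (p * suc j)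
∑-multiples zero    p h = refl
∑-multiples (suc t) p@(suc p-1) h = begin
  ∑[ i < p + t * p ] (𝟙 (p ∣? suc i) * h (suc i))
    ≡⟨ ∑-+ p (t * p) (λ i → 𝟙 (p ∣? suc i) * h (suc i)) ⟩
  ∑[ i < p ] (𝟙 (p ∣? suc i) * h (suc i)) + ∑[ i < t * p ] (𝟙 (p ∣? suc (p + i)) * h (suc (p + i)))
    ≡⟨ cong₂ _+_ first-block (∑-cong (t * p) (λ {i} _ → shifted-block i)) ⟩
  h p + ∑[ i < t * p ] (𝟙 (p ∣? suc i) * h (p + suc i))
    ≡⟨ cong₂ _+_ (cong h (sym (*-identityʳ p))) (∑-multiples t p (h ∘ (p +_))) ⟩
  h (p * 1) + ∑[ j < t ] h (p + p * suc j)
    ≡⟨ cong (h (p * 1) +_) (∑-cong t (λ {j} _ → cong h (sym (*-suc p (suc j))))) ⟩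
  h (p * 1) + ∑[ j < t ] h (p * suc (suc j))
    ∎
  where
  open ≡-Reasoning
  first-block : ∑[ i < p ] (𝟙 (p ∣? suc i) * h (suc i)) ≡ h p
  first-block = begin
    ∑[ i < p ] (𝟙 (p ∣? suc i) * h (suc i))                 ≡⟨ ∑-last p-1 (λ i → 𝟙 (p ∣? suc i) * h (suc i)) ⟩
    ∑[ i < p-1 ] (𝟙 (p ∣? suc i) * h (suc i)) + 𝟙 (p ∣? p) * h p
      ≡⟨ cong₂ _+_ (∑-zero p-1 (λ i<p-1 → cong (_* _) (𝟙-no (p ∣? _) (<⇒≱ (s≤s i<p-1) ∘ ∣⇒≤))))
                   (cong (_* h p) (𝟙-yes (p ∣? p) ∣-refl)) ⟩
    0 + 1 * h p                                            ≡⟨ *-identityˡ (h p) ⟩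
    h p                                                    ∎
  shifted-block : ∀ i → 𝟙 (p ∣? suc (p + i)) * h (suc (p + i)) ≡ 𝟙 (p ∣? suc i) * h (p + suc i)
  shifted-block i rewrite sym (+-suc p i) = cong (_* h (p + suc i)) (𝟙-cong ∣-+-self (p ∣? (p + suc i)) (p ∣? suc i))

covering-multiple : ∀ X p .{{_ : NonZero p}} → ∃ λ t → X ≤ t * p × t * p ≤ X + p
covering-multiple X p = suc (X / p) , X≤ , ≤X+p
  where
  X≤ : X ≤ suc (X / p) * p
  X≤ = begin
    X                    ≡⟨ m≡m%n+[m/n]*n X p ⟩
    X % p + X / p * p    ≤⟨ +-monoˡ-≤ _ (<⇒≤ (m%n<n X p)) ⟩
    p + X / p * p        ∎
    where open ≤-Reasoning
  ≤X+p : suc (X / p) * p ≤ X + p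
  ≤X+p = begin
    p + X / p * p        ≤⟨ +-monoʳ-≤ p (m/n*n≤m X p) ⟩
    p + X                ≡⟨ +-comm p X ⟩
    X + p                ∎
    where open ≤-Reasoning

count-multiples : ∀ p .{{_ : NonZero p}} Y → p * ∑[ i < Y ] 𝟙 (p ∣? suc i) ≤ Y + p
count-multiples p Y with t , Y≤tp , tp≤Y+p ← covering-multiple Y p = begin
  p * ∑[ i < Y ] 𝟙 (p ∣? suc i)                  ≤⟨ *-monoʳ-≤ p (∑-mono-bound (λ i → 𝟙 (p ∣? suc i)) Y≤tp) ⟩
  p * ∑[ i < t * p ] 𝟙 (p ∣? suc i)              ≡⟨ cong (p *_) (∑-cong (t * p) (λ {i} _ → sym (*-identityʳ _))) ⟩
  p * ∑[ i < t * p ] (𝟙 (p ∣? suc i) * 1)        ≡⟨ cong (p *_) (∑-multiples t p (λ _ → 1)) ⟩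
  p * ∑[ j < t ] 1                               ≡⟨ cong (p *_) (trans (∑-const t 1) (*-identityʳ t)) ⟩
  p * t                                          ≡⟨ *-comm p t ⟩
  t * p                                          ≤⟨ tp≤Y+p ⟩
  Y + p                                          ∎
  where open ≤-Reasoning

-- Repetition-free lists and integer intervals

module _ {A : Set} (_≟_ : DecidableEquality A) where

  Unique∧⊆⇒length≤ : ∀ {xs ys : List A} → Unique xs → xs ⊆ ys → length xs ≤ length ys
  Unique∧⊆⇒length≤ [] _ = z≤n
  Unique∧⊆⇒length≤ {x ∷ xs} {ys} (x∉xs ∷ xs!) xs⊆ys = begin-strict
    length xs                 ≤⟨ Unique∧⊆⇒length≤ xs! (λ z∈xs → ∈-filter⁺ ≢x? (xs⊆ys (there z∈xs)) (λ z≡x → All.lookup x∉xs z∈xs (sym z≡x))) ⟩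
    length (filter ≢x? ys)    <⟨ filter-notAll ≢x? ys (Any.map (λ x≡y y≢x → y≢x (sym x≡y)) (xs⊆ys (here refl))) ⟩
    length ys                 ∎
    where
    open ≤-Reasoning
    ≢x? = λ y → ¬? (y ≟ x)

length-filter-applyUpTo : ∀ {P : ℕ → Set} (P? : ∀ n → Dec (P n)) f n →
  length (filter P? (applyUpTo f n)) ≡ ∑[ i < n ] 𝟙 (P? (f i))
length-filter-applyUpTo P? f zero = refl
length-filter-applyUpTo P? f (suc n) with P? (f 0)
... | yes _ = cong suc (length-filter-applyUpTo P? (f ∘ suc) n)
... | no _  = length-filter-applyUpTo P? (f ∘ suc) n

Ioc≡applyUpTo : ∀ a b → Ioc a b ≡ applyUpTo (λ i → suc (a + i)) (b ∸ a)
Ioc≡applyUpTo a b = map-applyUpTo (λ i → i) (λ i → suc (a + i)) (b ∸ a)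

length-Ioc : ∀ a b → length (Ioc a b) ≡ b ∸ a
length-Ioc a b = trans (length-map _ (upTo (b ∸ a))) (length-upTo (b ∸ a))

length-filter-Ioc : ∀ {P : ℕ → Set} (P? : ∀ n → Dec (P n)) a b →
  length (filter P? (Ioc a b)) ≡ ∑[ i < b ∸ a ] 𝟙 (P? (suc (a + i)))
length-filter-Ioc P? a b =
  trans (cong (length ∘ filter P?) (Ioc≡applyUpTo a b)) (length-filter-applyUpTo P? _ (b ∸ a))

Ioc-unique : ∀ a b → Unique (Ioc a b)
Ioc-unique a b = Unique.map⁺ (+-cancelˡ-≡ a _ _ ∘ suc-injective) (Unique.upTo⁺ (b ∸ a))

∈-Ioc⁻ : ∀ {a b v} → v ∈ Ioc a b → a < v × v ≤ b
∈-Ioc⁻ {a} {b} v∈ with i , i<b∸a , refl ← Product.map₂ (Product.map₁ ∈-upTo⁻) (∈-map⁻ (λ i → suc (a + i)) v∈) =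
  s≤s (m≤m+n a i) , subst (_≤ b) (cong suc (+-comm i a)) (m≤o∸n⇒m+n≤o (suc i) (<⇒≤ a<b) i<b∸a)
  where
  a<b : a < b
  a<b = m∸n≢0⇒n<m (m<n⇒n≢0 i<b∸a)

∈-Ioc⁺ : ∀ {a b v} → a < v → v ≤ b → v ∈ Ioc a b
∈-Ioc⁺ {a} {b} {v} a<v v≤b = subst (_∈ Ioc a b) (m+[n∸m]≡n a<v) (∈-map⁺ (λ i → suc (a + i)) (∈-upTo⁺ i<b∸a))
  where
  i<b∸a : v ∸ suc a < b ∸ a
  i<b∸a = m+n≤o⇒m≤o∸n (suc (v ∸ suc a)) (subst (_≤ b) (sym (trans (cong suc (+-comm (v ∸ suc a) a)) (m+[n∸m]≡n a<v))) v≤b)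

shift-Ioc-overlap : ∀ a b → length (shift 1 (Ioc a b) ∩ Ioc a b) ≤ length (Ioc a b) ∸ 1
shift-Ioc-overlap a b = begin
  length (filter (_∈? F) (map suc F))    ≤⟨ Unique∧⊆⇒length≤ _≟_ overlap-unique overlap⊆ ⟩
  length (Ioc (suc a) b)                 ≡⟨ length-Ioc (suc a) b ⟩
  b ∸ suc a                              ≡⟨ pred[m∸n]≡m∸[1+n] b a ⟨
  (b ∸ a) ∸ 1                            ≡⟨ cong (_∸ 1) (length-Ioc a b) ⟨
  length F ∸ 1                           ∎
  where
  open ≤-Reasoning
  F = Ioc a b
  overlap-unique : Unique (filter (_∈? F) (map suc F))
  overlap-unique = Unique.filter⁺ (_∈? F) (Unique.map⁺ suc-injective (Ioc-unique a b))
  overlap⊆ : filter (_∈? F) (map suc F) ⊆ Ioc (suc a) b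
  overlap⊆ v∈ with v∈suc[F] , v∈F ← ∈-filter⁻ (_∈? F) {xs = map suc F} v∈ with w , w∈F , refl ← ∈-map⁻ suc {xs = F} v∈suc[F] =
    ∈-Ioc⁺ (s≤s (proj₁ (∈-Ioc⁻ w∈F))) (proj₂ (∈-Ioc⁻ v∈F))

Ioc-⊆-scaled : ∀ {x b q} → x < q * suc (b ∸ x) → 0 < b ∸ x → Ioc x b ⊆ Ioc 0 ((1 + 2 * q) * (b ∸ x))
Ioc-⊆-scaled {x} {b} {q} x<q[d+1] 0<d {v} v∈ with x<v , v≤b ← ∈-Ioc⁻ v∈ = ∈-Ioc⁺ (≤-<-trans z≤n x<v) (begin
  v                        ≤⟨ ≤-trans v≤b (m≤n+m∸n b x) ⟩
  x + d                    ≤⟨ +-monoˡ-≤ d (<⇒≤ x<q[d+1]) ⟩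
  q * suc d + d            ≡⟨ cong (_+ d) (*-suc q d) ⟩
  q + q * d + d            ≤⟨ +-monoˡ-≤ d (+-monoˡ-≤ (q * d) (m≤m*n q d ⦃ >-nonZero 0<d ⦄)) ⟩
  q * d + q * d + d        ≡⟨ collect q d ⟩
  (1 + 2 * q) * d          ∎)
  where
  open ≤-Reasoning
  d = b ∸ x
  collect : ∀ q d → q * d + q * d + d ≡ (1 + 2 * q) * d
  collect = solve-∀

-- Coprimality and Euler's totient

coprime-∣ˡ : ∀ {d a c} → d ∣ a → Coprime a c → Coprime d c
coprime-∣ˡ d∣a a⊥c (i∣d , i∣c) = a⊥c (∣-trans i∣d d∣a , i∣c)

coprime-∣ʳ : ∀ {d a c} → d ∣ c → Coprime a c → Coprime a d
coprime-∣ʳ d∣c a⊥c (i∣a , i∣d) = a⊥c (i∣a , ∣-trans i∣d d∣c)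

coprime-*ˡ : ∀ {a b c} → Coprime a c → Coprime b c → Coprime (a * b) c
coprime-*ˡ {a} a⊥c b⊥c {i} (i∣ab , i∣c) = b⊥c (coprime-divisor i⊥a i∣ab , i∣c)
  where
  i⊥a : Coprime i a
  i⊥a (j∣i , j∣a) = a⊥c (j∣a , ∣-trans j∣i i∣c)

coprime-*ʳ : ∀ {a b c} → Coprime c a → Coprime c b → Coprime c (a * b)
coprime-*ʳ c⊥a c⊥b = Coprime.sym (coprime-*ˡ (Coprime.sym c⊥a) (Coprime.sym c⊥b))

coprime-+-self : ∀ {k m} → Coprime (m + k) m ⇔ Coprime k m
coprime-+-self {k} {m} = mk⇔ to coprime-+
  where
  to : Coprime (m + k) m → Coprime k m
  to m+k⊥m (i∣k , i∣m) = m+k⊥m (∣m∣n⇒∣m+n i∣m i∣k , i∣m)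

prime>1 : ∀ {p} → Prime p → 1 < p
prime>1 {p} p-prime = nonTrivial⇒n>1 p {{prime⇒nonTrivial p-prime}}

prime∤⇒coprime : ∀ {p n} → Prime p → ¬ p ∣ n → Coprime p n
prime∤⇒coprime {p} p-prime p∤n {i} (i∣p , i∣n) with prime⇒irreducible p-prime i∣p
... | inj₁ i≡1 = i≡1
... | inj₂ refl = contradiction i∣n p∤n

prime∣⇒¬coprime : ∀ {p n} → Prime p → p ∣ n → ¬ Coprime p n
prime∣⇒¬coprime {p} p-prime p∣n p⊥n with () ← subst Prime (p⊥n (∣-refl , p∣n)) p-prime

prime∣product⇒∈ : ∀ {p qs} → Prime p → All Prime qs → p ∣ product qs → p ∈ qs
prime∣product⇒∈ {p} {[]}     p-prime []            p∣1 with () ← subst Prime (∣1⇒≡1 p∣1) p-prime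
prime∣product⇒∈ {p} {q ∷ qs} p-prime (q-prime ∷ ps) p∣q*qs with euclidsLemma q (product qs) p-prime p∣q*qs
... | inj₂ p∣qs = there (prime∣product⇒∈ p-prime ps p∣qs)
... | inj₁ p∣q with prime⇒irreducible q-prime p∣q
...   | inj₂ p≡q = here p≡q
...   | inj₁ refl with () ← p-prime

coprime-product : ∀ {qs P} → All (λ q → Coprime q P) qs → Coprime (product qs) P
coprime-product {P = P} []         = Coprime.1-coprimeTo P
coprime-product (q⊥P ∷ qs⊥P) = coprime-*ˡ q⊥P (coprime-product qs⊥P)

coprime-*-∣⇔ : ∀ {p m k} → p ∣ m → Coprime k (p * m) ⇔ Coprime k m
coprime-*-∣⇔ {p} p∣m = mk⇔ (coprime-∣ʳ (n∣m*n p)) (λ k⊥m → coprime-*ʳ (coprime-∣ʳ p∣m k⊥m) k⊥m)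

coprime-*-coprime⇔ : ∀ {p k m} → Coprime p m → Coprime (p * k) m ⇔ Coprime k m
coprime-*-coprime⇔ {p} p⊥m = mk⇔ (coprime-∣ˡ (n∣m*n p)) (coprime-*ˡ p⊥m)

coprime-*-prime⇔ : ∀ {p m k} → Prime p → (¬ p ∣ k × Coprime k m) ⇔ Coprime k (p * m)
coprime-*-prime⇔ {p} {m} {k} p-prime = mk⇔ to from
  where
  to : ¬ p ∣ k × Coprime k m → Coprime k (p * m)
  to (p∤k , k⊥m) = coprime-*ʳ (Coprime.sym (prime∤⇒coprime p-prime p∤k)) k⊥m
  from : Coprime k (p * m) → ¬ p ∣ k × Coprime k m
  from k⊥pm = (λ p∣k → prime∣⇒¬coprime p-prime p∣k (Coprime.sym (coprime-∣ʳ (m∣m*n m) k⊥pm))) , coprime-∣ʳ (n∣m*n p) k⊥pm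

φ-count : ∀ n → φ n ≡ ∑[ i < n ] 𝟙 (coprime? (suc i) n)
φ-count n = trans (length-filter-Ioc (λ k → gcd k n ≟ 1) 0 n)
                  (∑-cong n (λ {i} _ → 𝟙-cong (mk⇔ gcd≡1⇒coprime coprime⇒gcd≡1) (gcd (suc i) n ≟ 1) (coprime? (suc i) n)))

count-coprime-periodic : ∀ t m → ∑[ i < t * m ] 𝟙 (coprime? (suc i) m) ≡ t * φ m
count-coprime-periodic t m = begin
  ∑[ i < t * m ] 𝟙 (coprime? (suc i) m)     ≡⟨ ∑-periodic t m (λ i → 𝟙 (coprime? (suc i) m)) shifted ⟩
  t * ∑[ i < m ] 𝟙 (coprime? (suc i) m)     ≡⟨ cong (t *_) (φ-count m) ⟨
  t * φ m                                  ∎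
  where
  open ≡-Reasoning
  shifted : ∀ i → 𝟙 (coprime? (suc (m + i)) m) ≡ 𝟙 (coprime? (suc i) m)
  shifted i = trans (cong (λ k → 𝟙 (coprime? k m)) (sym (+-suc m i)))
                    (𝟙-cong coprime-+-self (coprime? (m + suc i) m) (coprime? (suc i) m))

φ-*-∣ : ∀ p m → p ∣ m → φ (p * m) ≡ p * φ m
φ-*-∣ p m p∣m = begin
  φ (p * m)                                     ≡⟨ φ-count (p * m) ⟩
  ∑[ i < p * m ] 𝟙 (coprime? (suc i) (p * m))    ≡⟨ ∑-cong (p * m) (λ {i} _ → 𝟙-cong (coprime-*-∣⇔ p∣m) (coprime? (suc i) (p * m)) (coprime? (suc i) m)) ⟩
  ∑[ i < p * m ] 𝟙 (coprime? (suc i) m)          ≡⟨ count-coprime-periodic p m ⟩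
  p * φ m                                       ∎
  where open ≡-Reasoning

-- Among the p * m residues, those coprime to m split into multiples of p (φ m of them) and non-multiples (φ (p * m)).
φ-*-prime : ∀ {p} m → Prime p → ¬ p ∣ m → φ (p * m) ≡ (p ∸ 1) * φ m
φ-*-prime {p@(suc r)} m p-prime p∤m = +-cancelˡ-≡ (φ m) _ _ (begin
  φ m + φ (p * m)                                                                   ≡⟨ cong₂ _+_ multiples non-multiples ⟨
  ∑[ i < p * m ] (𝟙 (p ∣? suc i) * c i) + ∑[ i < p * m ] (𝟙 (¬? (p ∣? suc i)) * c i) ≡⟨ ∑-split (p * m) (λ i → p ∣? suc i) c ⟨
  ∑[ i < p * m ] c i                                                                ≡⟨ count-coprime-periodic p m ⟩
  p * φ m                                                                           ∎)
  where
  open ≡-Reasoning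
  c = λ i → 𝟙 (coprime? (suc i) m)
  multiples : ∑[ i < p * m ] (𝟙 (p ∣? suc i) * c i) ≡ φ m
  multiples = begin
    ∑[ i < p * m ] (𝟙 (p ∣? suc i) * c i)      ≡⟨ cong (λ n → ∑[ i < n ] (𝟙 (p ∣? suc i) * c i)) (*-comm p m) ⟩
    ∑[ i < m * p ] (𝟙 (p ∣? suc i) * c i)      ≡⟨ ∑-multiples m p (λ k → 𝟙 (coprime? k m)) ⟩
    ∑[ j < m ] 𝟙 (coprime? (p * suc j) m)     ≡⟨ ∑-cong m (λ {j} _ → 𝟙-cong (coprime-*-coprime⇔ (prime∤⇒coprime p-prime p∤m)) (coprime? (p * suc j) m) (coprime? (suc j) m)) ⟩
    ∑[ j < m ] c j                            ≡⟨ φ-count m ⟨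
    φ m                                       ∎
  non-multiples : ∑[ i < p * m ] (𝟙 (¬? (p ∣? suc i)) * c i) ≡ φ (p * m)
  non-multiples = trans (∑-cong (p * m) (λ {i} _ → trans (𝟙-*-×-dec (¬? (p ∣? suc i)) (coprime? (suc i) m))
                                                        (𝟙-cong (coprime-*-prime⇔ p-prime) (¬? (p ∣? suc i) ×-dec coprime? (suc i) m) (coprime? (suc i) (p * m)))))
                        (sym (φ-count (p * m)))

φ[1] : φ 1 ≡ 1
φ[1] = refl

φ-product : ∀ {ps} → All Prime ps → Unique ps → φ (product ps) ≡ product (map pred ps)
φ-product {[]}     []                  []             = φ[1]
φ-product {p ∷ ps} (p-prime ∷ ps-prime) (p∉ps ∷ ps!) = begin
  φ (p * product ps)                 ≡⟨ φ-*-prime (product ps) p-prime (λ p∣ps → All.lookup p∉ps (prime∣product⇒∈ p-prime ps-prime p∣ps) refl) ⟩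
  pred p * φ (product ps)            ≡⟨ cong (pred p *_) (φ-product ps-prime ps!) ⟩
  pred p * product (map pred ps)     ∎
  where open ≡-Reasoning

count-coprime : ∀ M P .{{_ : NonZero P}} X → M * φ P ≤ P → M * ∑[ i < X ] 𝟙 (coprime? (suc i) P) ≤ X + P
count-coprime M P X Mφ≤P with t , X≤tP , tP≤X+P ← covering-multiple X P = begin
  M * ∑[ i < X ] 𝟙 (coprime? (suc i) P)         ≤⟨ *-monoʳ-≤ M (∑-mono-bound (λ i → 𝟙 (coprime? (suc i) P)) X≤tP) ⟩
  M * ∑[ i < t * P ] 𝟙 (coprime? (suc i) P)     ≡⟨ cong (M *_) (count-coprime-periodic t P) ⟩
  M * (t * φ P)                                ≡⟨ x*[y*z]≡y*[x*z] M t (φ P) ⟩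
  t * (M * φ P)                                ≤⟨ *-monoʳ-≤ t Mφ≤P ⟩
  t * P                                        ≤⟨ tP≤X+P ⟩
  X + P                                        ∎
  where
  open ≤-Reasoning
  x*[y*z]≡y*[x*z] : ∀ x y z → x * (y * z) ≡ y * (x * z)
  x*[y*z]≡y*[x*z] = solve-∀

𝟙-any?-∷ : ∀ {P : ℕ → Set} (P? : ∀ x → Dec (P x)) x xs → 𝟙 (any? P? (x ∷ xs)) ≤ 𝟙 (P? x) + 𝟙 (any? P? xs)
𝟙-any?-∷ P? x xs with P? x | any? P? xs
... | yes _ | _     = s≤s z≤n
... | no _  | yes _ = ≤-refl
... | no _  | no _  = z≤n

count-coprime-to-some : ∀ M Q X Ps → All (λ P → NonZero P × M * φ P ≤ P × P ≤ Q) Ps →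
                        M * ∑[ i < X ] 𝟙 (any? (coprime? (suc i)) Ps) ≤ length Ps * (X + Q)
count-coprime-to-some M Q X [] [] = ≤-reflexive (trans (cong (M *_) (∑-zero X (λ _ → refl))) (*-zeroʳ M))
count-coprime-to-some M Q X (P ∷ Ps) ((P≢0 , Mφ≤P , P≤Q) ∷ sparse) = begin
  M * ∑[ i < X ] 𝟙 (any? (coprime? (suc i)) (P ∷ Ps))
    ≤⟨ *-monoʳ-≤ M (∑-mono-≤ X (λ {i} _ → 𝟙-any?-∷ (coprime? (suc i)) P Ps)) ⟩
  M * ∑[ i < X ] (𝟙 (coprime? (suc i) P) + 𝟙 (any? (coprime? (suc i)) Ps))
    ≡⟨ trans (cong (M *_) (∑-distrib-+ X)) (*-distribˡ-+ M _ _) ⟩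
  M * ∑[ i < X ] 𝟙 (coprime? (suc i) P) + M * ∑[ i < X ] 𝟙 (any? (coprime? (suc i)) Ps)
    ≤⟨ +-mono-≤ (count-coprime M P {{P≢0}} X Mφ≤P) (count-coprime-to-some M Q X Ps sparse) ⟩
  X + P + length Ps * (X + Q)
    ≤⟨ +-monoˡ-≤ _ (+-monoʳ-≤ X P≤Q) ⟩
  X + Q + length Ps * (X + Q)
    ∎
  where open ≤-Reasoning

-- Powers of 2 dividing φ

nonCoprimeCount : ℕ → List ℕ → ℕ
nonCoprimeCount n []       = 0
nonCoprimeCount n (P ∷ Ps) = 𝟙 (¬? (coprime? n P)) + nonCoprimeCount n Ps

nonCoprimeCount-mono : ∀ {m n Ps} → All (λ P → Coprime m P → Coprime n P) Ps → nonCoprimeCount n Ps ≤ nonCoprimeCount m Ps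
nonCoprimeCount-mono {m} {n} {[]}     []           = z≤n
nonCoprimeCount-mono {m} {n} {P ∷ Ps} (m⊥⇒n⊥ ∷ hs) =
  +-mono-≤ (𝟙-mono (¬? (coprime? n P)) (¬? (coprime? m P)) (λ ¬n⊥P m⊥P → ¬n⊥P (m⊥⇒n⊥ m⊥P))) (nonCoprimeCount-mono hs)

nonCoprimeCount-*-∣ : ∀ {p} m Ps → p ∣ m → nonCoprimeCount (p * m) Ps ≤ nonCoprimeCount m Ps
nonCoprimeCount-*-∣ m Ps p∣m = nonCoprimeCount-mono {Ps = Ps} (All.tabulate (λ _ m⊥P → coprime-*ˡ (coprime-∣ˡ p∣m m⊥P) m⊥P))

nonCoprimeCount-*-coprime : ∀ {p} m Ps → All (Coprime p) Ps → nonCoprimeCount (p * m) Ps ≤ nonCoprimeCount m Ps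
nonCoprimeCount-*-coprime {p} m Ps p⊥Ps = nonCoprimeCount-mono {Ps = Ps} (All.map coprime-*ˡ′ p⊥Ps)
  where
  coprime-*ˡ′ : ∀ {P} → Coprime p P → Coprime m P → Coprime (p * m) P
  coprime-*ˡ′ = coprime-*ˡ

nonCoprimeCount-*-prime : ∀ {p} m {Ps} → Prime p → AllPairs Coprime Ps → nonCoprimeCount (p * m) Ps ≤ suc (nonCoprimeCount m Ps)
nonCoprimeCount-*-prime     m {[]}     _       _                 = z≤n
nonCoprimeCount-*-prime {p} m {P ∷ Ps} p-prime (P⊥Ps ∷ pairwise) with p ∣? P
... | yes p∣P = begin
  𝟙 (¬? (coprime? (p * m) P)) + nonCoprimeCount (p * m) Ps
    ≤⟨ +-mono-≤ (𝟙≤1 (¬? (coprime? (p * m) P))) (nonCoprimeCount-*-coprime m Ps (All.map (coprime-∣ˡ p∣P) P⊥Ps)) ⟩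
  suc (nonCoprimeCount m Ps)
    ≤⟨ s≤s (m≤n+m _ _) ⟩
  suc (𝟙 (¬? (coprime? m P)) + nonCoprimeCount m Ps)
    ∎
  where open ≤-Reasoning
... | no p∤P = begin
  𝟙 (¬? (coprime? (p * m) P)) + nonCoprimeCount (p * m) Ps
    ≤⟨ +-mono-≤ (𝟙-mono (¬? (coprime? (p * m) P)) (¬? (coprime? m P)) (λ ¬pm⊥P m⊥P → ¬pm⊥P (coprime-*ˡ (prime∤⇒coprime p-prime p∤P) m⊥P)))
                (nonCoprimeCount-*-prime m p-prime pairwise) ⟩
  𝟙 (¬? (coprime? m P)) + suc (nonCoprimeCount m Ps)
    ≡⟨ +-suc _ _ ⟩
  suc (𝟙 (¬? (coprime? m P)) + nonCoprimeCount m Ps)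
    ∎
  where open ≤-Reasoning

nonCoprimeCount[1] : ∀ Ps → nonCoprimeCount 1 Ps ≡ 0
nonCoprimeCount[1] []       = refl
nonCoprimeCount[1] (P ∷ Ps) = cong₂ _+_ (𝟙-no (¬? (coprime? 1 P)) (λ ¬1⊥P → ¬1⊥P (Coprime.1-coprimeTo P))) (nonCoprimeCount[1] Ps)

nonCoprimeCount<length⇒coprime : ∀ n Ps → nonCoprimeCount n Ps < length Ps → Any (Coprime n) Ps
nonCoprimeCount<length⇒coprime n (P ∷ Ps) count<length with coprime? n P
... | yes n⊥P = here n⊥P
... | no _    = there (nonCoprimeCount<length⇒coprime n Ps (≤-pred count<length))

even⊎odd : ∀ n → 2 ∣ n ⊎ 2 ∣ suc n
even⊎odd zero    = inj₁ (2 ∣0)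
even⊎odd (suc n) with even⊎odd n
... | inj₁ 2∣n   = inj₂ (∣m∣n⇒∣m+n (∣-refl {2}) 2∣n)
... | inj₂ 2∣1+n = inj₁ 2∣1+n

odd⇒2∣pred : ∀ r → ¬ 2 ∣ suc r → 2 ∣ r
odd⇒2∣pred r 2∤1+r with even⊎odd r
... | inj₁ 2∣r   = 2∣r
... | inj₂ 2∣1+r = contradiction 2∣1+r 2∤1+r

^-monoʳ-∣ : ∀ m {k j} → k ≤ j → m ^ k ∣ m ^ j
^-monoʳ-∣ m {k} {j} k≤j = subst (m ^ k ∣_) (trans (sym (^-distribˡ-+-* m k (j ∸ k))) (cong (m ^_) (m+[n∸m]≡n k≤j))) (m∣m*n _)

scale-bound : ∀ x {a} B c → a ≤ B * c → x * a ≤ B * (x * c)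
scale-bound x B c a≤Bc = ≤-trans (*-monoʳ-≤ x a≤Bc) (≤-reflexive (x*[B*c]≡B*[x*c] x B c))
  where
  x*[B*c]≡B*[x*c] : ∀ x B c → x * (B * c) ≡ B * (x * c)
  x*[B*c]≡B*[x*c] = solve-∀

-- ω plays the role of the number of distinct odd primes dividing n: each of them contributes a
-- factor 2 to φ n, shares a factor with at most one of the pairwise coprime Ps, and at most doubles n / φ n.
record TwoAdicBound (Ps : List ℕ) (n : ℕ) : Set where
  field
    ω            : ℕ
    2^ω∣φ        : 2 ^ ω ∣ φ n
    count≤ω      : nonCoprimeCount n Ps ≤ ω
    n≤2^[1+ω]φ   : n ≤ 2 ^ suc ω * φ n
    odd⇒n≤2^ωφ   : ¬ 2 ∣ n → n ≤ 2 ^ ω * φ n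

module _ {Ps : List ℕ} where

  open TwoAdicBound

  twoAdicBound-*-∣ : ∀ {p m} → p ∣ m → TwoAdicBound Ps m → TwoAdicBound Ps (p * m)
  twoAdicBound-*-∣ {p} {m} p∣m b = record
    { ω          = ω b
    ; 2^ω∣φ      = subst (2 ^ ω b ∣_) (sym φpm) (∣n⇒∣m*n p (2^ω∣φ b))
    ; count≤ω    = ≤-trans (nonCoprimeCount-*-∣ m Ps p∣m) (count≤ω b)
    ; n≤2^[1+ω]φ = subst (λ f → p * m ≤ 2 ^ suc (ω b) * f) (sym φpm) (scale-bound p (2 ^ suc (ω b)) (φ m) (n≤2^[1+ω]φ b))
    ; odd⇒n≤2^ωφ = λ 2∤pm → subst (λ f → p * m ≤ 2 ^ ω b * f) (sym φpm)
                                  (scale-bound p (2 ^ ω b) (φ m) (odd⇒n≤2^ωφ b (2∤pm ∘ ∣n⇒∣m*n p)))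
    }
    where
    φpm = φ-*-∣ p m p∣m

  twoAdicBound-*-2 : ∀ {m} → All (Coprime 2) Ps → ¬ 2 ∣ m → TwoAdicBound Ps m → TwoAdicBound Ps (2 * m)
  twoAdicBound-*-2 {m} 2⊥Ps 2∤m b = record
    { ω          = ω b
    ; 2^ω∣φ      = subst (2 ^ ω b ∣_) (sym φ2m) (2^ω∣φ b)
    ; count≤ω    = ≤-trans (nonCoprimeCount-*-coprime m Ps 2⊥Ps) (count≤ω b)
    ; n≤2^[1+ω]φ = subst (λ f → 2 * m ≤ 2 ^ suc (ω b) * f) (sym φ2m)
                         (≤-trans (*-monoʳ-≤ 2 (odd⇒n≤2^ωφ b 2∤m)) (≤-reflexive (sym (*-assoc 2 (2 ^ ω b) (φ m)))))
    ; odd⇒n≤2^ωφ = λ 2∤2m → contradiction (m∣m*n m) 2∤2m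
    }
    where
    φ2m : φ (2 * m) ≡ φ m
    φ2m = trans (φ-*-prime m prime[2] 2∤m) (*-identityˡ (φ m))

  twoAdicBound-*-oddPrime : ∀ {p m} → AllPairs Coprime Ps → Prime p → ¬ 2 ∣ p → ¬ p ∣ m →
                            TwoAdicBound Ps m → TwoAdicBound Ps (p * m)
  twoAdicBound-*-oddPrime {p@(suc r)} {m} pairwise p-prime 2∤p p∤m b = record
    { ω          = suc (ω b)
    ; 2^ω∣φ      = subst (2 ^ suc (ω b) ∣_) (sym φpm) (*-pres-∣ (odd⇒2∣pred r 2∤p) (2^ω∣φ b))
    ; count≤ω    = ≤-trans (nonCoprimeCount-*-prime m p-prime pairwise) (s≤s (count≤ω b))
    ; n≤2^[1+ω]φ = subst (λ f → p * m ≤ 2 ^ suc (suc (ω b)) * f) (sym φpm) (doubled (2 ^ suc (ω b)) (n≤2^[1+ω]φ b))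
    ; odd⇒n≤2^ωφ = λ 2∤pm → subst (λ f → p * m ≤ 2 ^ suc (ω b) * f) (sym φpm)
                                  (doubled (2 ^ ω b) (odd⇒n≤2^ωφ b (2∤pm ∘ ∣n⇒∣m*n p)))
    }
    where
    φpm : φ (p * m) ≡ r * φ m
    φpm = φ-*-prime m p-prime p∤m
    p≤2r : p ≤ 2 * r
    p≤2r = begin
      1 + r        ≤⟨ +-monoˡ-≤ r (≤-pred (prime>1 p-prime)) ⟩
      r + r        ≡⟨ cong (r +_) (+-identityʳ r) ⟨
      2 * r        ∎
      where open ≤-Reasoning
    doubled : ∀ B → m ≤ B * φ m → p * m ≤ 2 * B * (r * φ m)
    doubled B m≤Bφ = begin
      p * m                ≤⟨ *-monoˡ-≤ m p≤2r ⟩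
      2 * r * m            ≤⟨ *-monoʳ-≤ (2 * r) m≤Bφ ⟩
      2 * r * (B * φ m)    ≡⟨ rearrange r B (φ m) ⟩
      2 * B * (r * φ m)    ∎
      where
      open ≤-Reasoning
      rearrange : ∀ r B c → 2 * r * (B * c) ≡ 2 * B * (r * c)
      rearrange = solve-∀

  twoAdicBound-product : AllPairs Coprime Ps → All (Coprime 2) Ps → ∀ {fs} → All Prime fs → TwoAdicBound Ps (product fs)
  twoAdicBound-product _ _ {[]} [] = record
    { ω = 0 ; 2^ω∣φ = 1∣ 1 ; count≤ω = ≤-reflexive (nonCoprimeCount[1] Ps) ; n≤2^[1+ω]φ = s≤s z≤n ; odd⇒n≤2^ωφ = λ _ → ≤-refl }
  twoAdicBound-product pairwise 2⊥Ps {p ∷ fs} (p-prime ∷ fs-prime)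
    with b ← twoAdicBound-product pairwise 2⊥Ps fs-prime | p ∣? product fs | p ≟ 2
  ... | yes p∣m | _        = twoAdicBound-*-∣ p∣m b
  ... | no p∤m  | yes refl = twoAdicBound-*-2 2⊥Ps p∤m b
  ... | no p∤m  | no p≢2   = twoAdicBound-*-oddPrime pairwise p-prime 2∤p p∤m b
    where
    2∤p : ¬ 2 ∣ p
    2∤p 2∣p with prime⇒irreducible p-prime 2∣p
    ... | inj₂ 2≡p = p≢2 (sym 2≡p)

totient-2-adic : ∀ {Ps} → AllPairs Coprime Ps → All (Coprime 2) Ps →
                 ∀ n .{{_ : NonZero n}} k → ¬ 2 ^ k ∣ φ n → nonCoprimeCount n Ps < k × n ≤ 2 ^ k * φ n
totient-2-adic {Ps} pairwise 2⊥Ps n k 2^k∤φn = conclude (subst (TwoAdicBound Ps) (sym isFactorisation) bound)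
  where
  open PrimeFactorisation (factorise n)
  bound = twoAdicBound-product pairwise 2⊥Ps factorsPrime
  conclude : TwoAdicBound Ps n → nonCoprimeCount n Ps < k × n ≤ 2 ^ k * φ n
  conclude b with k ≤? TwoAdicBound.ω b
  ... | yes k≤ω = contradiction (∣-trans (^-monoʳ-∣ 2 k≤ω) (TwoAdicBound.2^ω∣φ b)) 2^k∤φn
  ... | no k≰ω  = <-≤-trans (s≤s (TwoAdicBound.count≤ω b)) (≰⇒> k≰ω) ,
                  ≤-trans (TwoAdicBound.n≤2^[1+ω]φ b) (*-monoˡ-≤ (φ n) (^-monoʳ-≤ 2 (≰⇒> k≰ω)))

-- Smooth numbers and the Euler product

Smooth : ℕ → ℕ → Set
Smooth w n = ∀ {q} → Prime q → q ∣ n → q ≤ w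

smooth? : ∀ w n .{{_ : NonZero n}} → Dec (Smooth w n)
smooth? w n@(suc _) = Dec.map′ from-bounded (λ smooth _ → smooth) (allUpTo? (λ q → prime? q →-dec q ∣? n →-dec q ≤? w) (suc n))
  where
  from-bounded : (∀ {q} → q < suc n → Prime q → q ∣ n → q ≤ w) → Smooth w n
  from-bounded bounded q-prime q∣n = bounded (s≤s (∣⇒≤ q∣n)) q-prime q∣n

smooth-≤ : ∀ {w n} .{{_ : NonZero n}} → n ≤ w → Smooth w n
smooth-≤ n≤w _ q∣n = ≤-trans (∣⇒≤ q∣n) n≤w

smooth-suc : ∀ {w n} → Smooth w n → Smooth (suc w) n
smooth-suc smooth q-prime q∣n = m≤n⇒m≤1+n (smooth q-prime q∣n)

smooth-suc⁻ : ∀ {w n} → ¬ (Prime (suc w) × suc w ∣ n) → Smooth (suc w) n → Smooth w n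
smooth-suc⁻ {w} excluded smooth {q} q-prime q∣n with q ≟ suc w
... | yes refl = contradiction (q-prime , q∣n) excluded
... | no q≢1+w = ≤-pred (≤∧≢⇒< (smooth q-prime q∣n) q≢1+w)

smooth-*⁻ : ∀ {w} p {j} → Smooth w (p * j) → Smooth w j
smooth-*⁻ p smooth q-prime q∣j = smooth q-prime (∣n⇒∣m*n p q∣j)

∃-prime-divisor : ∀ n .{{_ : NonZero n}} → 1 < n → ∃ λ q → Prime q × q ∣ n
∃-prime-divisor n 1<n with factorise n
... | record { factors = [] ; isFactorisation = refl } = contradiction 1<n (<-irrefl refl)
... | record { factors = q ∷ qs ; isFactorisation = n≡q*qs ; factorsPrime = q-prime ∷ _ } =
  q , q-prime , subst (q ∣_) (sym n≡q*qs) (m∣m*n (product qs))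

¬smooth-0 : ∀ n .{{_ : NonZero n}} → 1 < n → ¬ Smooth 0 n
¬smooth-0 n 1<n smooth with q , q-prime , q∣n ← ∃-prime-divisor n 1<n = <⇒≱ (prime>1 q-prime) (≤-trans (smooth q-prime q∣n) z≤n)

smoothQuotient : ℕ → ℕ → ℕ → ℕ
smoothQuotient w L zero      = 0
smoothQuotient w L k@(suc _) = 𝟙 (smooth? w k) * (L / k)

smoothHarmonic : ℕ → ℕ → ℕ → ℕ
smoothHarmonic w N L = ∑[ i < N ] smoothQuotient w L (suc i)

primesIn : ℕ → ℕ → List ℕ
primesIn z zero    = []
primesIn z (suc n) with prime? (suc (z + n))
... | yes _ = suc (z + n) ∷ primesIn z n
... | no _  = primesIn z n

∈-primesIn⁻ : ∀ {q} z n → q ∈ primesIn z n → Prime q × z < q × q ≤ z + n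
∈-primesIn⁻ z (suc n) q∈ with prime? (suc (z + n))
∈-primesIn⁻ z (suc n) (here refl) | yes p-prime = p-prime , s≤s (m≤m+n z n) , ≤-reflexive (sym (+-suc z n))
∈-primesIn⁻ z (suc n) (there q∈)  | yes _       = Product.map₂ (Product.map₂ (λ q≤z+n → ≤-trans q≤z+n (+-monoʳ-≤ z (n≤1+n n)))) (∈-primesIn⁻ z n q∈)
∈-primesIn⁻ z (suc n) q∈          | no _        = Product.map₂ (Product.map₂ (λ q≤z+n → ≤-trans q≤z+n (+-monoʳ-≤ z (n≤1+n n)))) (∈-primesIn⁻ z n q∈)

primesIn-prime : ∀ z n → All Prime (primesIn z n)
primesIn-prime z n = All.tabulate (proj₁ ∘ ∈-primesIn⁻ z n)

primesIn-unique : ∀ z n → Unique (primesIn z n)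
primesIn-unique z zero    = []
primesIn-unique z (suc n) with prime? (suc (z + n))
... | yes _ = All.tabulate (λ q∈ p≡q → <-irrefl (sym p≡q) (s≤s (proj₂ (proj₂ (∈-primesIn⁻ z n q∈))))) ∷ primesIn-unique z n
... | no _  = primesIn-unique z n

primesIn-++ : ∀ z n → primesIn 0 (z + n) ≡ primesIn z n ++ primesIn 0 z
primesIn-++ z zero    = cong (primesIn 0) (+-identityʳ z)
primesIn-++ z (suc n) rewrite +-suc z n with prime? (suc (z + n))
... | yes _ = cong (suc (z + n) ∷_) (primesIn-++ z n)
... | no _  = primesIn-++ z n

Π Φ : ℕ → ℕ → ℕ
Π z n = product (primesIn z n)
Φ z n = product (map pred (primesIn z n))

φ-Π : ∀ z n → φ (Π z n) ≡ Φ z n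
φ-Π z n = φ-product (primesIn-prime z n) (primesIn-unique z n)

Π-++ : ∀ z n → Π 0 (z + n) ≡ Π z n * Π 0 z
Π-++ z n = trans (cong product (primesIn-++ z n)) (product-++ (primesIn z n) (primesIn 0 z))

Φ-++ : ∀ z n → Φ 0 (z + n) ≡ Φ z n * Φ 0 z
Φ-++ z n = trans (cong (product ∘ map pred) (primesIn-++ z n))
                 (trans (cong product (map-++ pred (primesIn z n) (primesIn 0 z))) (product-++ (map pred (primesIn z n)) _))

Φ≤Π : ∀ z n → Φ z n ≤ Π z n
Φ≤Π z n = go (primesIn z n)
  where
  go : ∀ ps → product (map pred ps) ≤ product ps
  go []       = ≤-refl
  go (p ∷ ps) = *-mono-≤ (pred[n]≤n {p}) (go ps)

Φ≥1 : ∀ z n → 1 ≤ Φ z n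
Φ≥1 z n = go (primesIn-prime z n)
  where
  go : ∀ {ps} → All Prime ps → 1 ≤ product (map pred ps)
  go []                    = ≤-refl
  go (p-prime ∷ ps-prime) = *-mono-≤ (∸-monoˡ-≤ 1 (prime>1 p-prime)) (go ps-prime)

Π≥1 : ∀ z n → 1 ≤ Π z n
Π≥1 z n = productOfPrimes≥1 (primesIn-prime z n)

smoothHarmonic-0 : ∀ N L → smoothHarmonic 0 N L ≤ L
smoothHarmonic-0 zero    L = z≤n
smoothHarmonic-0 (suc N) L = begin
  𝟙 (smooth? 0 1) * (L / 1) + ∑[ i < N ] smoothQuotient 0 L (2 + i)   ≡⟨ cong (𝟙 (smooth? 0 1) * (L / 1) +_) (∑-zero N (λ {i} _ → not-smooth i)) ⟩
  𝟙 (smooth? 0 1) * (L / 1) + 0                                      ≤⟨ +-monoˡ-≤ 0 (≤-trans (𝟙*≤ (smooth? 0 1) (L / 1)) (m/n≤m L 1)) ⟩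
  L + 0                                                              ≡⟨ +-identityʳ L ⟩
  L                                                                  ∎
  where
  open ≤-Reasoning
  not-smooth : ∀ i → smoothQuotient 0 L (2 + i) ≡ 0
  not-smooth i = cong (_* (L / (2 + i))) (𝟙-no (smooth? 0 (2 + i)) (¬smooth-0 (2 + i) (s≤s (s≤s z≤n))))

smoothHarmonic-L≡0 : ∀ w N → smoothHarmonic w N 0 ≡ 0
smoothHarmonic-L≡0 w N = ∑-zero N (λ {i} _ → trans (cong (𝟙 (smooth? w (suc i)) *_) (0/n≡0 (suc i))) (*-zeroʳ (𝟙 (smooth? w (suc i)))))

smoothHarmonic-nonprime : ∀ w N L → ¬ Prime (suc w) → smoothHarmonic (suc w) N L ≡ smoothHarmonic w N L
smoothHarmonic-nonprime w N L composite = ∑-cong N (λ {i} _ → cong (_* (L / suc i)) (𝟙-cong (same i) (smooth? (suc w) (suc i)) (smooth? w (suc i))))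
  where
  same : ∀ i → Smooth (suc w) (suc i) ⇔ Smooth w (suc i)
  same i = mk⇔ (smooth-suc⁻ (composite ∘ proj₁)) smooth-suc

smoothHarmonic-prime : ∀ w N L → Prime (suc w) →
  smoothHarmonic (suc w) N L ≤ smoothHarmonic w N L + smoothHarmonic (suc w) N (L / suc w)
smoothHarmonic-prime w N L p-prime = begin
  ∑[ i < N ] f i                                                               ≡⟨ ∑-split N (λ i → p ∣? suc i) f ⟩
  ∑[ i < N ] (𝟙 (p ∣? suc i) * f i) + ∑[ i < N ] (𝟙 (¬? (p ∣? suc i)) * f i)   ≤⟨ +-mono-≤ multiples non-multiples ⟩
  smoothHarmonic p N (L / p) + smoothHarmonic w N L                            ≡⟨ +-comm (smoothHarmonic p N (L / p)) _ ⟩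
  smoothHarmonic w N L + smoothHarmonic p N (L / p)                            ∎
  where
  open ≤-Reasoning
  p = suc w
  f = λ i → smoothQuotient p L (suc i)
  non-multiples : ∑[ i < N ] (𝟙 (¬? (p ∣? suc i)) * f i) ≤ smoothHarmonic w N L
  non-multiples = ∑-mono-≤ N λ {i} _ → begin
    𝟙 (¬? (p ∣? suc i)) * (𝟙 (smooth? p (suc i)) * (L / suc i))     ≡⟨ *-assoc (𝟙 (¬? (p ∣? suc i))) _ _ ⟨
    𝟙 (¬? (p ∣? suc i)) * 𝟙 (smooth? p (suc i)) * (L / suc i)       ≡⟨ cong (_* (L / suc i)) (𝟙-*-×-dec (¬? (p ∣? suc i)) (smooth? p (suc i))) ⟩
    𝟙 (¬? (p ∣? suc i) ×-dec smooth? p (suc i)) * (L / suc i)       ≤⟨ *-monoˡ-≤ (L / suc i) (𝟙-mono (¬? (p ∣? suc i) ×-dec smooth? p (suc i)) (smooth? w (suc i)) (λ (p∤ , smooth) → smooth-suc⁻ (p∤ ∘ proj₂) smooth)) ⟩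
    𝟙 (smooth? w (suc i)) * (L / suc i)                             ∎
  multiples : ∑[ i < N ] (𝟙 (p ∣? suc i) * f i) ≤ smoothHarmonic p N (L / p)
  multiples = begin
    ∑[ i < N ] (𝟙 (p ∣? suc i) * f i)          ≤⟨ ∑-mono-bound (λ i → 𝟙 (p ∣? suc i) * f i) (m≤m*n N p) ⟩
    ∑[ i < N * p ] (𝟙 (p ∣? suc i) * f i)      ≡⟨ ∑-multiples N p (smoothQuotient p L) ⟩
    ∑[ j < N ] smoothQuotient p L (p * suc j)  ≤⟨ ∑-mono-≤ N (λ {j} _ → *-mono-≤ (𝟙-mono (smooth? p (p * suc j)) (smooth? p (suc j)) (smooth-*⁻ p))
                                                                                (≤-reflexive (sym (m/n/o≡m/[n*o] L p (suc j))))) ⟩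
    smoothHarmonic p N (L / p)                 ∎

-- Integer form of ∑ {1 / k : k w-smooth} = ∏ {p / (p - 1) : p ≤ w prime}.
smoothHarmonic-bound : ∀ w N L → Φ 0 w * smoothHarmonic w N L ≤ L * Π 0 w
smoothHarmonic-bound zero N L = begin
  1 * smoothHarmonic 0 N L     ≡⟨ *-identityˡ _ ⟩
  smoothHarmonic 0 N L         ≤⟨ smoothHarmonic-0 N L ⟩
  L                            ≡⟨ *-identityʳ L ⟨
  L * 1                        ∎
  where open ≤-Reasoning
smoothHarmonic-bound (suc w) N L with prime? (suc w)
... | no composite = subst (λ s → Φ 0 w * s ≤ L * Π 0 w) (sym (smoothHarmonic-nonprime w N L composite)) (smoothHarmonic-bound w N L)
... | yes p-prime  = go L (<-wellFounded L)
  where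
  p = suc w
  go : ∀ L → Acc _<_ L → w * Φ 0 w * smoothHarmonic p N L ≤ L * (p * Π 0 w)
  go zero      _         = ≤-reflexive (trans (cong (w * Φ 0 w *_) (smoothHarmonic-L≡0 p N)) (*-zeroʳ (w * Φ 0 w)))
  go L@(suc _) (acc rec) = begin
    w * Φ 0 w * smoothHarmonic p N L
      ≤⟨ *-monoʳ-≤ (w * Φ 0 w) (smoothHarmonic-prime w N L p-prime) ⟩
    w * Φ 0 w * (smoothHarmonic w N L + smoothHarmonic p N (L / p))
      ≡⟨ distribute w (Φ 0 w) (smoothHarmonic w N L) _ ⟩
    w * (Φ 0 w * smoothHarmonic w N L) + w * Φ 0 w * smoothHarmonic p N (L / p)
      ≤⟨ +-mono-≤ (*-monoʳ-≤ w (smoothHarmonic-bound w N L)) (go (L / p) (rec (m/n<m L p (prime>1 p-prime)))) ⟩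
    w * (L * Π 0 w) + L / p * (p * Π 0 w)
      ≤⟨ +-monoʳ-≤ (w * (L * Π 0 w)) (≤-trans (≤-reflexive (sym (*-assoc (L / p) p (Π 0 w)))) (*-monoˡ-≤ (Π 0 w) (m/n*n≤m L p))) ⟩
    w * (L * Π 0 w) + L * Π 0 w
      ≡⟨ collect w L (Π 0 w) ⟩
    L * (p * Π 0 w)
      ∎
    where
    open ≤-Reasoning
    distribute : ∀ w e s t → w * e * (s + t) ≡ w * (e * s) + w * e * t
    distribute = solve-∀
    collect : ∀ w L P → w * (L * P) + L * P ≡ L * (suc w * P)
    collect = solve-∀

smoothHarmonic-complete : ∀ w N L → N ≤ w → smoothHarmonic w N L ≡ ∑[ i < N ] (L / suc i)
smoothHarmonic-complete w N L N≤w =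
  ∑-cong N (λ {i} i<N → trans (cong (_* (L / suc i)) (𝟙-yes (smooth? w (suc i)) (smooth-≤ (≤-trans i<N N≤w)))) (*-identityˡ (L / suc i)))

harmonic-lower-bound : ∀ m → m * 2 ^ m ≤ 2 * ∑[ i < 2 ^ m ] (2 ^ m / suc i)
harmonic-lower-bound zero    = z≤n
harmonic-lower-bound (suc m) = begin
  suc m * (2 * a)                       ≡⟨ expand m a ⟩
  2 * (m * a) + 2 * a                   ≤⟨ +-monoˡ-≤ (2 * a) (*-monoʳ-≤ 2 (harmonic-lower-bound m)) ⟩
  2 * (2 * H a) + 2 * a                 ≡⟨ *-distribˡ-+ 2 (2 * H a) a ⟨
  2 * (2 * H a + a)                     ≤⟨ *-monoʳ-≤ 2 (+-mono-≤ doubled tail) ⟩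
  2 * (∑[ i < a ] (2 * a / suc i) + ∑[ i < a ] (2 * a / suc (a + i)))
                                        ≡⟨ cong (2 *_) (∑-+ a a (λ i → 2 * a / suc i)) ⟨
  2 * ∑[ i < a + a ] (2 * a / suc i)    ≡⟨ cong (λ n → 2 * ∑[ i < n ] (2 * a / suc i)) (cong (a +_) (sym (*-identityˡ a))) ⟩
  2 * ∑[ i < 2 * a ] (2 * a / suc i)    ∎
  where
  open ≤-Reasoning
  a = 2 ^ m
  H = λ a → ∑[ i < a ] (a / suc i)
  expand : ∀ m a → suc m * (2 * a) ≡ 2 * (m * a) + 2 * a
  expand = solve-∀
  twice-floor : ∀ k .{{_ : NonZero k}} → 2 * (a / k) ≤ 2 * a / k
  twice-floor k = ≤-trans (≤-reflexive (sym (m*n/n≡m (2 * (a / k)) k)))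
                          (/-monoˡ-≤ k (≤-trans (≤-reflexive (*-assoc 2 (a / k) k)) (*-monoʳ-≤ 2 (m/n*n≤m a k))))
  doubled : 2 * H a ≤ ∑[ i < a ] (2 * a / suc i)
  doubled = ≤-trans (≤-reflexive (sym (∑-*-distribˡ a 2 (λ i → a / suc i)))) (∑-mono-≤ a (λ {i} _ → twice-floor (suc i)))
  tail : a ≤ ∑[ i < a ] (2 * a / suc (a + i))
  tail = begin
    a                                  ≡⟨ trans (∑-const a 1) (*-identityʳ a) ⟨
    ∑[ i < a ] 1                       ≤⟨ ∑-mono-≤ a (λ {i} i<a → ≤-trans (≤-reflexive (sym (n/n≡1 (suc (a + i)))))
                                                                          (/-monoˡ-≤ (suc (a + i)) (≤-trans (≤-reflexive (sym (+-suc a i))) (+-monoʳ-≤ a (≤-trans i<a (≤-reflexive (sym (+-identityʳ a)))))))) ⟩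
    ∑[ i < a ] (2 * a / suc (a + i))   ∎

-- For w = 2^(2K) every k ≤ w is w-smooth, so the smooth harmonic sum is a full harmonic sum, at least K w.
euler-product-unbounded : ∀ K → ∃ λ w → K * Φ 0 w ≤ Π 0 w
euler-product-unbounded K = a , *-cancelˡ-≤ 2 (*-cancelʳ-≤ (2 * (K * Φ 0 a)) (2 * Π 0 a) a ⦃ m^n≢0 2 (2 * K) ⦄ (begin
  2 * (K * Φ 0 a) * a                    ≡⟨ reorder K (Φ 0 a) a ⟩
  Φ 0 a * (2 * K * a)                    ≤⟨ *-monoʳ-≤ (Φ 0 a) (harmonic-lower-bound (2 * K)) ⟩
  Φ 0 a * (2 * ∑[ i < a ] (a / suc i))    ≡⟨ cong (λ s → Φ 0 a * (2 * s)) (smoothHarmonic-complete a a a ≤-refl) ⟨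
  Φ 0 a * (2 * smoothHarmonic a a a)     ≡⟨ x*[y*z]≡y*[x*z] (Φ 0 a) 2 _ ⟩
  2 * (Φ 0 a * smoothHarmonic a a a)     ≤⟨ *-monoʳ-≤ 2 (smoothHarmonic-bound a a a) ⟩
  2 * (a * Π 0 a)                        ≡⟨ cong (2 *_) (*-comm a (Π 0 a)) ⟩
  2 * (Π 0 a * a)                        ≡⟨ *-assoc 2 (Π 0 a) a ⟨
  2 * Π 0 a * a                          ∎))
  where
  open ≤-Reasoning
  a = 2 ^ (2 * K)
  reorder : ∀ K e a → 2 * (K * e) * a ≡ e * (2 * K * a)
  reorder = solve-∀
  x*[y*z]≡y*[x*z] : ∀ x y z → x * (y * z) ≡ y * (x * z)
  x*[y*z]≡y*[x*z] = solve-∀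

-- Dropping the primes ≤ z loses at most the factor Π 0 z, which is absorbed by starting from K = M · Π 0 z.
sparse-prime-block : ∀ z M → ∃ λ n → M * Φ z n ≤ Π z n
sparse-prime-block z M = extend (euler-product-unbounded K)
  where
  K = M * Π 0 z
  extend : ∃ (λ w → K * Φ 0 w ≤ Π 0 w) → ∃ λ n → M * Φ z n ≤ Π z n
  extend (w , KΦ≤Π) = w , (begin
    M * Φ z w                     ≤⟨ m≤m*n (M * Φ z w) (Φ 0 z) ⦃ >-nonZero (Φ≥1 0 z) ⦄ ⟩
    M * Φ z w * Φ 0 z             ≤⟨ *-cancelʳ-≤ _ _ (Π 0 z) ⦃ >-nonZero (Π≥1 0 z) ⦄ whole ⟩
    Π z w                         ∎)
    where
    open ≤-Reasoning
    rearrange : ∀ M P a b → M * a * b * P ≡ M * P * (a * b)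
    rearrange = solve-∀
    swap : ∀ a K b → K * (a * b) ≡ a * (K * b)
    swap = solve-∀
    whole : M * Φ z w * Φ 0 z * Π 0 z ≤ Π z w * Π 0 z
    whole = begin
      M * Φ z w * Φ 0 z * Π 0 z     ≡⟨ rearrange M (Π 0 z) (Φ z w) (Φ 0 z) ⟩
      K * (Φ z w * Φ 0 z)           ≡⟨ cong (K *_) (trans (sym (Φ-++ z w)) (trans (cong (Φ 0) (+-comm z w)) (Φ-++ w z))) ⟩
      K * (Φ w z * Φ 0 w)           ≡⟨ swap (Φ w z) K (Φ 0 w) ⟩
      Φ w z * (K * Φ 0 w)           ≤⟨ *-mono-≤ (Φ≤Π w z) KΦ≤Π ⟩
      Π w z * Π 0 w                 ≡⟨ trans (sym (Π-++ w z)) (trans (cong (Π 0) (+-comm w z)) (Π-++ z w)) ⟩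
      Π z w * Π 0 z                 ∎

-- Blocks of consecutive primes

PrimeDivisorsAbove : ℕ → ℕ → Set
PrimeDivisorsAbove z P = ∀ {q} → Prime q → q ∣ P → z < q

Π-above : ∀ z n → PrimeDivisorsAbove z (Π z n)
Π-above z n q-prime q∣Π = proj₁ (proj₂ (∈-primesIn⁻ z n (prime∣product⇒∈ q-prime (primesIn-prime z n) q∣Π)))

above-mono : ∀ {z z′ P} → z′ ≤ z → PrimeDivisorsAbove z P → PrimeDivisorsAbove z′ P
above-mono z′≤z above q-prime q∣P = ≤-<-trans z′≤z (above q-prime q∣P)

above⇒coprime : ∀ {z P q} → Prime q → q ≤ z → PrimeDivisorsAbove z P → Coprime q P
above⇒coprime q-prime q≤z above = prime∤⇒coprime q-prime (λ q∣P → <⇒≱ (above q-prime q∣P) q≤z)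

coprime-Π : ∀ z n {P} → PrimeDivisorsAbove (z + n) P → Coprime (Π z n) P
coprime-Π z n above = coprime-product (All.tabulate (λ q∈ →
  let (q-prime , _ , q≤z+n) = ∈-primesIn⁻ z n q∈ in above⇒coprime q-prime q≤z+n above))

record SieveBlocks (k M z : ℕ) : Set where
  field
    Ps       : List ℕ
    bound    : ℕ
    length≡k : length Ps ≡ k
    pairwise : AllPairs Coprime Ps
    above    : All (PrimeDivisorsAbove z) Ps
    sparse   : All (λ P → NonZero P × M * φ P ≤ P × P ≤ bound) Ps

sieveBlocks : ∀ k M z → SieveBlocks k M z
sieveBlocks zero    M z = record { Ps = [] ; bound = 0 ; length≡k = refl ; pairwise = [] ; above = [] ; sparse = [] }
sieveBlocks (suc k) M z = extend (sparse-prime-block z M)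
  where
  extend : ∃ (λ n → M * Φ z n ≤ Π z n) → SieveBlocks (suc k) M z
  extend (n , MΦ≤Π) = record
    { Ps       = B ∷ Ps
    ; bound    = B + bound
    ; length≡k = cong suc length≡k
    ; pairwise = All.map (coprime-Π z n) above ∷ pairwise
    ; above    = Π-above z n ∷ All.map (above-mono (m≤m+n z n)) above
    ; sparse   = (productOfPrimes≢0 (primesIn-prime z n) , subst (λ f → M * f ≤ B) (sym (φ-Π z n)) MΦ≤Π , m≤m+n B bound)
               ∷ All.map (Product.map₂ (Product.map₂ (λ P≤bound → ≤-trans P≤bound (m≤n+m bound B)))) sparse
    }
    where
    B = Π z n
    open SieveBlocks (sieveBlocks k M (z + n))

sieveBlocks-count : ∀ c p .{{_ : NonZero p}} {z} (blocks : SieveBlocks c (c * (c * p)) z) Y →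
  let open SieveBlocks blocks in c * ∑[ i < p * Y ] 𝟙 (any? (coprime? (suc i)) Ps) ≤ Y + bound
sieveBlocks-count zero      p blocks Y = z≤n
sieveBlocks-count c@(suc _) p blocks Y = *-cancelˡ-≤ (c * p) ⦃ m*n≢0 c p ⦄ (begin
  c * p * (c * B)               ≡⟨ reorder c p B ⟩
  c * (c * p) * B               ≤⟨ count-coprime-to-some (c * (c * p)) bound (p * Y) Ps sparse ⟩
  length Ps * (p * Y + bound)   ≡⟨ cong (_* (p * Y + bound)) length≡k ⟩
  c * (p * Y + bound)           ≤⟨ *-monoʳ-≤ c (+-monoʳ-≤ (p * Y) (m≤n*m bound p)) ⟩
  c * (p * Y + p * bound)       ≡⟨ factor c p Y bound ⟩
  c * p * (Y + bound)           ∎)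
  where
  open ≤-Reasoning
  open SieveBlocks blocks
  B = ∑[ i < p * Y ] 𝟙 (any? (coprime? (suc i)) Ps)
  reorder : ∀ c p B → c * p * (c * B) ≡ c * (c * p) * B
  reorder = solve-∀
  factor : ∀ c p Y b → c * (p * Y + p * b) ≡ c * p * (Y + b)
  factor = solve-∀

-- Totient values have density zero

-- By totient-2-adic, a totient value φ n ≤ Y not divisible by 2^k has n ≤ 2^k Y and n coprime to a block.
totient-values-count : ∀ {Ps} → AllPairs Coprime Ps → All (Coprime 2) Ps → ∀ k Y {L} → length Ps ≡ k →
  Unique L → All (λ v → v ∈ Ioc 0 Y × V v) L →
  length L ≤ ∑[ i < Y ] 𝟙 (2 ^ k ∣? suc i) + ∑[ i < 2 ^ k * Y ] 𝟙 (any? (coprime? (suc i)) Ps)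
totient-values-count {Ps} pairwise odd k Y {L} length≡k L! L⊆ = begin
  length L                                ≤⟨ Unique∧⊆⇒length≤ _≟_ L! (λ v∈L → split (All.lookup L⊆ v∈L)) ⟩
  length (multiples ++ map φ coprimes)    ≡⟨ length-++ multiples ⟩
  length multiples + length (map φ coprimes)
    ≡⟨ cong₂ _+_ (length-filter-Ioc (λ v → 2 ^ k ∣? v) 0 Y)
                 (trans (length-map φ coprimes) (length-filter-Ioc (λ n → any? (coprime? n) Ps) 0 (2 ^ k * Y))) ⟩
  ∑[ i < Y ] 𝟙 (2 ^ k ∣? suc i) + ∑[ i < 2 ^ k * Y ] 𝟙 (any? (coprime? (suc i)) Ps)
    ∎
  where
  open ≤-Reasoning
  multiples = filter (λ v → 2 ^ k ∣? v) (Ioc 0 Y)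
  coprimes  = filter (λ n → any? (coprime? n) Ps) (Ioc 0 (2 ^ k * Y))
  split : ∀ {v} → v ∈ Ioc 0 Y × V v → v ∈ multiples ++ map φ coprimes
  split {v} (v∈ , m , φn≡v) with 2 ^ k ∣? v
  ... | yes 2^k∣v = ∈-++⁺ˡ (∈-filter⁺ (λ v → 2 ^ k ∣? v) v∈ 2^k∣v)
  ... | no 2^k∤v  = ∈-++⁺ʳ multiples (subst (_∈ map φ coprimes) φn≡v (∈-map⁺ φ (∈-filter⁺ (λ n → any? (coprime? n) Ps) n∈ n-coprime)))
    where
    n = suc m
    bounds = totient-2-adic pairwise odd n k (subst (λ x → ¬ 2 ^ k ∣ x) (sym φn≡v) 2^k∤v)
    n∈ : n ∈ Ioc 0 (2 ^ k * Y)
    n∈ = ∈-Ioc⁺ z<s (≤-trans (proj₂ bounds) (*-monoʳ-≤ (2 ^ k) (subst (_≤ Y) (sym φn≡v) (proj₂ (∈-Ioc⁻ v∈)))))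
    n-coprime : Any (Coprime n) Ps
    n-coprime = nonCoprimeCount<length⇒coprime n Ps (subst (nonCoprimeCount n Ps <_) (sym length≡k) (proj₁ bounds))

n≤2^n : ∀ n → n ≤ 2 ^ n
n≤2^n zero    = z≤n
n≤2^n (suc n) = +-mono-≤ (^-monoʳ-≤ 2 {0} {n} z≤n) (≤-trans (n≤2^n n) (≤-reflexive (sym (+-identityʳ (2 ^ n)))))

ZeroDensity : (ℕ → Set) → Set
ZeroDensity A = ∀ T → ∃ λ Y₀ → ∀ {Y} → Y₀ ≤ Y → ∀ {L} → Unique L → All (λ v → v ∈ Ioc 0 Y × A v) L → T * length L ≤ Y

-- With c = 3 T blocks satisfying c² 2^c φ P ≤ P, both counts of totient-values-count are at most (Y + Y₀) / c.
V-zeroDensity : ZeroDensity V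
V-zeroDensity zero      = 0 , λ _ _ _ → z≤n
V-zeroDensity T@(suc _) = p + bound , sparse-values
  where
  c = 3 * T
  p = 2 ^ c
  blocks = sieveBlocks c (c * (c * p)) 2
  open SieveBlocks blocks
  sparse-values : ∀ {Y} → p + bound ≤ Y → ∀ {L} → Unique L → All (λ v → v ∈ Ioc 0 Y × V v) L → T * length L ≤ Y
  sparse-values {Y} Y₀≤Y {L} L! L⊆ = *-cancelˡ-≤ 3 (begin
    3 * (T * length L)          ≡⟨ *-assoc 3 T (length L) ⟨
    c * length L                ≤⟨ *-monoʳ-≤ c (totient-values-count pairwise odd c Y length≡k L! L⊆) ⟩
    c * (A + B)                 ≡⟨ *-distribˡ-+ c A B ⟩
    c * A + c * B               ≤⟨ +-mono-≤ (≤-trans (*-monoˡ-≤ A (n≤2^n c)) (count-multiples p ⦃ m^n≢0 2 c ⦄ Y)) cB≤ ⟩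
    (Y + p) + (Y + bound)       ≤⟨ ≤-reflexive (regroup Y p bound) ⟩
    Y + (Y + (p + bound))       ≤⟨ +-monoʳ-≤ Y (+-monoʳ-≤ Y Y₀≤Y) ⟩
    Y + (Y + Y)                 ≡⟨ cong (λ x → Y + (Y + x)) (+-identityʳ Y) ⟨
    3 * Y                       ∎)
    where
    open ≤-Reasoning
    odd = All.map (above⇒coprime prime[2] ≤-refl) above
    A = ∑[ i < Y ] 𝟙 (p ∣? suc i)
    B = ∑[ i < p * Y ] 𝟙 (any? (coprime? (suc i)) Ps)
    regroup : ∀ Y p b → (Y + p) + (Y + b) ≡ Y + (Y + (p + b))
    regroup = solve-∀
    cB≤ : c * B ≤ Y + bound
    cB≤ = sieveBlocks-count c p ⦃ m^n≢0 2 c ⦄ blocks Y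

-- Natural numbers inside the rationals

ι≡mkℚ : ∀ n → ι n ≡ mkℚ (ℤ.+ n) 0 (Coprime.sym (Coprime.1-coprimeTo n))
ι≡mkℚ n = ℚ.normalize-coprime (Coprime.sym (Coprime.1-coprimeTo n))

ι-mono-≤ : ∀ {m n} → m ≤ n → ι m ℚ.≤ ι n
ι-mono-≤ {m} {n} m≤n rewrite ι≡mkℚ m | ι≡mkℚ n =
  *≤* (subst₂ ℤ._≤_ (sym (ℤ.*-identityʳ (ℤ.+ m))) (sym (ℤ.*-identityʳ (ℤ.+ n))) (+≤+ m≤n))

ι-mono-< : ∀ {m n} → m < n → ι m ℚ.< ι n
ι-mono-< {m} {n} m<n rewrite ι≡mkℚ m | ι≡mkℚ n =
  *<* (subst₂ ℤ._<_ (sym (ℤ.*-identityʳ (ℤ.+ m))) (sym (ℤ.*-identityʳ (ℤ.+ n))) (+<+ m<n))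

ι-cancel-< : ∀ {m n} → ι m ℚ.< ι n → m < n
ι-cancel-< {m} {n} ιm<ιn rewrite ι≡mkℚ m | ι≡mkℚ n
  with +<+ m<n ← subst₂ ℤ._<_ (ℤ.*-identityʳ (ℤ.+ m)) (ℤ.*-identityʳ (ℤ.+ n)) (ℚ.drop-*<* ιm<ιn) = m<n

ι-+ : ∀ m n → ι (m + n) ≡ ι m ℚ.+ ι n
ι-+ m n rewrite ι≡mkℚ m | ι≡mkℚ n = cong (ℚ._/ 1) (sym (cong₂ ℤ._+_ (ℤ.*-identityʳ (ℤ.+ m)) (ℤ.*-identityʳ (ℤ.+ n))))

ι-* : ∀ m n → ι (m * n) ≡ ι m ℚ.* ι n
ι-* m n rewrite ι≡mkℚ m | ι≡mkℚ n = cong (ℚ._/ 1) (ℤ.pos-* m n)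

ι-nonNeg : ∀ n → NonNegative (ι n)
ι-nonNeg n = ℚ.normalize-nonNeg n 1

ι-pos : ∀ n .{{_ : NonZero n}} → Positive (ι n)
ι-pos n = ℚ.normalize-pos n 1

ι-distance : ∀ {m n} → m ≤ n → ℚ.∣ ι m ℚ.- ι n ∣ ≡ ι (n ∸ m)
ι-distance {m} {n} m≤n = begin
  ℚ.∣ ι m ℚ.- ι n ∣                        ≡⟨ cong (λ k → ℚ.∣ ι m ℚ.- ι k ∣) (m+[n∸m]≡n m≤n) ⟨
  ℚ.∣ ι m ℚ.- ι (m + k) ∣                  ≡⟨ cong (λ t → ℚ.∣ ι m ℚ.- t ∣) (ι-+ m k) ⟩
  ℚ.∣ ι m ℚ.- (ι m ℚ.+ ι k) ∣              ≡⟨ cong (λ t → ℚ.∣ ι m ℚ.+ t ∣) (ℚ.neg-distrib-+ (ι m) (ι k)) ⟩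
  ℚ.∣ ι m ℚ.+ (ℚ.- ι m ℚ.+ ℚ.- ι k) ∣      ≡⟨ cong ℚ.∣_∣ (ℚ.+-assoc (ι m) (ℚ.- ι m) (ℚ.- ι k)) ⟨
  ℚ.∣ ι m ℚ.- ι m ℚ.+ ℚ.- ι k ∣            ≡⟨ cong (λ t → ℚ.∣ t ℚ.+ ℚ.- ι k ∣) (ℚ.+-inverseʳ (ι m)) ⟩
  ℚ.∣ 0ℚ ℚ.+ ℚ.- ι k ∣                     ≡⟨ cong ℚ.∣_∣ (ℚ.+-identityˡ (ℚ.- ι k)) ⟩
  ℚ.∣ ℚ.- ι k ∣                            ≡⟨ ℚ.∣-p∣≡∣p∣ (ι k) ⟩
  ℚ.∣ ι k ∣                                ≡⟨ ℚ.0≤p⇒∣p∣≡p (ℚ.nonNegative⁻¹ (ι k) {{ι-nonNeg k}}) ⟩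
  ι k                                      ∎
  where
  open ≡-Reasoning
  k = n ∸ m

ℚ-+-cancelˡ-< : ∀ r {p q} → r ℚ.+ p ℚ.< r ℚ.+ q → p ℚ.< q
ℚ-+-cancelˡ-< r {p} {q} r+p<r+q = subst₂ ℚ._<_ (cancel p) (cancel q) (ℚ.+-monoʳ-< (ℚ.- r) r+p<r+q)
  where
  cancel : ∀ x → ℚ.- r ℚ.+ (r ℚ.+ x) ≡ x
  cancel x = trans (sym (ℚ.+-assoc (ℚ.- r) r x)) (trans (cong (ℚ._+ x) (ℚ.+-inverseˡ r)) (ℚ.+-identityˡ x))

module _ (r : ℚ) (n d : ℕ) .{{_ : NonZero d}} (r*d≡n : r ℚ.* ι d ≡ ι n) where

  private
    scaled : ∀ b → r ℚ.* ι b ℚ.* ι d ≡ ι (n * b)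
    scaled b = begin
      r ℚ.* ι b ℚ.* ι d       ≡⟨ ℚ.*-assoc r (ι b) (ι d) ⟩
      r ℚ.* (ι b ℚ.* ι d)     ≡⟨ cong (r ℚ.*_) (ℚ.*-comm (ι b) (ι d)) ⟩
      r ℚ.* (ι d ℚ.* ι b)     ≡⟨ ℚ.*-assoc r (ι d) (ι b) ⟨
      r ℚ.* ι d ℚ.* ι b       ≡⟨ cong (ℚ._* ι b) r*d≡n ⟩
      ι n ℚ.* ι b             ≡⟨ ι-* n b ⟨
      ι (n * b)               ∎
      where open ≡-Reasoning

  ι≤r*ι : ∀ a b → a * d ≤ n * b → ι a ℚ.≤ r ℚ.* ι b
  ι≤r*ι a b ad≤nb = ℚ.*-cancelʳ-≤-pos (ι d) {{ι-pos d}}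
    (subst₂ ℚ._≤_ (ι-* a d) (sym (scaled b)) (ι-mono-≤ ad≤nb))

  r*ι<ι : ∀ a b → n * b < a * d → r ℚ.* ι b ℚ.< ι a
  r*ι<ι a b nb<ad = ℚ.*-cancelʳ-<-nonNeg (ι d) {{ι-nonNeg d}}
    (subst₂ ℚ._<_ (sym (scaled b)) (ι-* a d) (ι-mono-< {n * b} {a * d} nb<ad))

  r*ι<ι⁻ : ∀ a b → r ℚ.* ι b ℚ.< ι a → n * b < a * d
  r*ι<ι⁻ a b rb<a = ι-cancel-<
    (subst₂ ℚ._<_ (scaled b) (sym (ι-* a d)) (ℚ.*-monoˡ-<-pos (ι d) {{ι-pos d}} rb<a))

  ι<r*ι⁻ : ∀ a b → ι a ℚ.< r ℚ.* ι b → a * d < n * b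
  ι<r*ι⁻ a b a<rb = ι-cancel-<
    (subst₂ ℚ._<_ (sym (ι-* a d)) (scaled b) (ℚ.*-monoˡ-<-pos (ι d) {{ι-pos d}} a<rb))

mkℚ-*-denominator : ∀ n d-1 .(c : Coprime n (suc d-1)) → mkℚ (ℤ.+ n) d-1 c ℚ.* ι (suc d-1) ≡ ι n
mkℚ-*-denominator n d-1 c rewrite ι≡mkℚ (suc d-1) | ι≡mkℚ n =
  ℚ.toℚᵘ-injective (ℚᵘ.≃-trans (ℚ.toℚᵘ-homo-* (mkℚ (ℤ.+ n) d-1 c) (mkℚ (ℤ.+ suc d-1) 0 (Coprime.sym (Coprime.1-coprimeTo (suc d-1))))) (ℚᵘ.*≡* cross))
  where
  cross : (ℤ.+ n ℤ.* ℤ.+ suc d-1) ℤ.* ℤ.+ 1 ≡ ℤ.+ n ℤ.* ℤ.+ (suc d-1 * 1)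
  cross = trans (ℤ.*-identityʳ _) (cong (λ k → ℤ.+ n ℤ.* ℤ.+ k) (sym (*-identityʳ (suc d-1))))

positive-fraction : ∀ {r} → 0ℚ ℚ.< r → ∃₂ λ n d → r ℚ.* ι (suc d) ≡ ι (suc n)
positive-fraction {mkℚ (ℤ.+ suc n) d c} _ = n , d , mkℚ-*-denominator (suc n) d c
positive-fraction {mkℚ (ℤ.+ 0) _ _}    (*<* (+<+ ()))
positive-fraction {mkℚ ℤ.-[1+ _ ] _ _} (*<* ())

floor-< : ∀ r → 0ℚ ℚ.≤ r → r ℚ.< ι (suc ℤ.∣ floor r ∣)
floor-< r@(mkℚ ℤ.-[1+ _ ] _ _) 0≤r with () ← ℚ.nonNegative 0≤r
floor-< r@(mkℚ (ℤ.+ n) d-1 c)  _   = subst₂ ℚ._<_ (ℚ.*-identityʳ r) (cong (ι ∘ suc) (sym ∣floor∣≡))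
  (r*ι<ι r n (suc d-1) (mkℚ-*-denominator n d-1 c) (suc (n / suc d-1)) 1 (begin-strict
    n * 1                              ≡⟨ *-identityʳ n ⟩
    n                                  ≡⟨ m≡m%n+[m/n]*n n (suc d-1) ⟩
    n % suc d-1 + n / suc d-1 * suc d-1 <⟨ +-monoˡ-< _ (m%n<n n (suc d-1)) ⟩
    suc (n / suc d-1) * suc d-1        ∎))
  where
  open ≤-Reasoning
  ∣floor∣≡ : ℤ.∣ floor r ∣ ≡ n / suc d-1
  ∣floor∣≡ = cong ℤ.∣_∣ (ℤ.*-identityˡ (ℤ.+ (n / suc d-1)))

≤-floor : ∀ r {m} → 0ℚ ℚ.≤ r → ι m ℚ.≤ r → m ≤ ℤ.∣ floor r ∣
≤-floor r 0≤r m≤r = ≤-pred (ι-cancel-< (ℚ.≤-<-trans m≤r (floor-< r 0≤r)))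

-- Følner sequences of intervals

-- Shifting an interval by 1 loses its largest point, so the Følner condition for g = 1 and ε = 1 / (D + 1)
-- forces the length to exceed D.
Folner-Ioc-unbounded : ∀ (a b : ℕ → ℕ) → Folner (λ n → Ioc (a n) (b n)) →
                       ∀ D → ∃ λ N → ∀ n → N ≤ n → D < length (Ioc (a n) (b n))
Folner-Ioc-unbounded a b folner D =
  Product.map₂ (λ almost-invariant n N≤n → grows (shift-Ioc-overlap (a n) (b n)) (almost-invariant n N≤n))
               (folner 1 ε (*<* (+<+ (s≤s z≤n))))
  where
  ε = mkℚ (ℤ.+ 1) D (Coprime.1-coprimeTo (suc D))
  grows : ∀ {I d} → I ≤ d ∸ 1 → ℚ.∣ ι I ℚ.- ι d ∣ ℚ.< ε ℚ.* ι d → D < d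
  grows {I} {zero} _ gap<0 =
    contradiction (ℚ.≤-<-trans (ℚ.0≤∣p∣ (ι I ℚ.- ι 0)) (subst (ℚ.∣ ι I ℚ.- ι 0 ∣ ℚ.<_) (ℚ.*-zeroʳ ε) gap<0)) (ℚ.<-irrefl refl)
  grows {I} {d@(suc _)} I≤d-1 gap<εd =
    <⇒≤ (subst₂ _<_ (*-identityˡ (suc D)) (*-identityˡ d) (ι<r*ι⁻ ε 1 (suc D) (mkℚ-*-denominator 1 D _) 1 d one<εd))
    where
    one<εd : ι 1 ℚ.< ε ℚ.* ι d
    one<εd = ℚ.≤-<-trans (subst (ι 1 ℚ.≤_) (sym (ι-distance (≤-trans I≤d-1 (n≤1+n _)))) (ι-mono-≤ (m<n⇒0<n∸m (s≤s I≤d-1))))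
                         gap<εd

-- x α₀ ≤ x α < |F| + 1, because ⌊x (1 + α)⌋ = x + |F|.
Fseq-start-bound : ∀ {α₀} a q → α₀ ℚ.* ι (suc q) ≡ ι (suc a) → 0ℚ ℚ.< α₀ → ∀ x {α} → α₀ ℚ.< α →
                   let b = ℤ.∣ floor (ι x ℚ.* (1ℚ ℚ.+ α)) ∣ in x < suc q * suc (b ∸ x)
Fseq-start-bound {α₀} a q α₀-fraction 0<α₀ x {α} α₀<α = begin-strict
  x                  ≤⟨ m≤m+n x (a * x) ⟩
  suc a * x          <⟨ r*ι<ι⁻ α₀ (suc a) (suc q) α₀-fraction (suc d) x (subst (ℚ._< ι (suc d)) (ℚ.*-comm (ι x) α₀) xα₀<1+d) ⟩
  suc d * suc q      ≡⟨ *-comm (suc d) (suc q) ⟩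
  suc q * suc d      ∎
  where
  open ≤-Reasoning
  r = ι x ℚ.* (1ℚ ℚ.+ α)
  b = ℤ.∣ floor r ∣
  d = b ∸ x
  0≤ιx : 0ℚ ℚ.≤ ι x
  0≤ιx = ℚ.nonNegative⁻¹ (ι x) {{ι-nonNeg x}}
  0≤xα : 0ℚ ℚ.≤ ι x ℚ.* α
  0≤xα = ℚ.nonNegative⁻¹ _ {{ℚ.nonNeg*nonNeg⇒nonNeg (ι x) {{ι-nonNeg x}} α {{ℚ.nonNegative (ℚ.<⇒≤ (ℚ.<-trans 0<α₀ α₀<α))}}}}
  r≡ : r ≡ ι x ℚ.+ ι x ℚ.* α
  r≡ = trans (ℚ.*-distribˡ-+ (ι x) 1ℚ α) (cong (ℚ._+ ι x ℚ.* α) (ℚ.*-identityʳ (ι x)))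
  ιx≤r : ι x ℚ.≤ r
  ιx≤r = subst₂ ℚ._≤_ (ℚ.+-identityʳ (ι x)) (sym r≡) (ℚ.+-monoʳ-≤ (ι x) 0≤xα)
  0≤r : 0ℚ ℚ.≤ r
  0≤r = ℚ.≤-trans 0≤ιx ιx≤r
  ι[1+b]≡ : ι (suc b) ≡ ι x ℚ.+ ι (suc d)
  ι[1+b]≡ = trans (cong ι (trans (cong suc (sym (m+[n∸m]≡n (≤-floor r {x} 0≤r ιx≤r)))) (sym (+-suc x d)))) (ι-+ x (suc d))
  xα₀<1+d : ι x ℚ.* α₀ ℚ.< ι (suc d)
  xα₀<1+d = ℚ-+-cancelˡ-< (ι x) (ℚ.≤-<-trans (ℚ.+-monoʳ-≤ (ι x) (ℚ.*-monoˡ-≤-nonNeg (ι x) {{ι-nonNeg x}} (ℚ.<⇒≤ α₀<α)))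
                               (subst₂ ℚ._<_ r≡ ι[1+b]≡ (floor-< r 0≤r)))

Fseq-window : ∀ {α₀} a q → α₀ ℚ.* ι (suc q) ≡ ι (suc a) → 0ℚ ℚ.< α₀ → ∀ x {α} → α₀ ℚ.< α →
              let F = Ioc x ℤ.∣ floor (ι x ℚ.* (1ℚ ℚ.+ α)) ∣ in 0 < length F → F ⊆ Ioc 0 ((1 + 2 * suc q) * length F)
Fseq-window a q α₀-fraction 0<α₀ x {α} α₀<α 0<d =
  subst (λ d → F ⊆ Ioc 0 ((1 + 2 * suc q) * d)) (sym (length-Ioc x b))
        (Ioc-⊆-scaled {x} {b} {suc q} (Fseq-start-bound a q α₀-fraction 0<α₀ x α₀<α) (subst (0 <_) (length-Ioc x b) 0<d))
  where
  b = ℤ.∣ floor (ι x ℚ.* (1ℚ ℚ.+ α)) ∣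
  F = Ioc x b

zeroDensity⇒upperDensityZero : ∀ {A} x α {α₀} → 0ℚ ℚ.< α₀ → (∀ n → α₀ ℚ.< α n) →
  Folner (Fseq x α) → ZeroDensity A → UpperDensityZero (Fseq x α) A
zeroDensity⇒upperDensityZero x α 0<α₀ α₀<α folner zeroDensity ε 0<ε =
  let (a , q , α₀-fraction) = positive-fraction 0<α₀
      (e , s , ε-fraction)  = positive-fraction 0<ε
      C                     = 1 + 2 * suc q
      (Y₀ , sparse)         = zeroDensity (C * suc s)
      (N , large)           = Folner-Ioc-unbounded x _ folner Y₀
  in N , λ n N≤n L L! L⊆F →
    let d       = length (Fseq x α n)
        window  = Fseq-window a q α₀-fraction 0<α₀ (x n) (α₀<α n) (≤-<-trans z≤n (large n N≤n))
        C*s*L≤C*d = sparse (≤-trans (<⇒≤ (large n N≤n)) (m≤n*m d C)) L! (All.map (Product.map₁ window) L⊆F)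
        s*L≤d   = *-cancelˡ-≤ C (subst (_≤ C * d) (*-assoc C (suc s) (length L)) C*s*L≤C*d)
    in ι≤r*ι ε (suc e) (suc s) ε-fraction (length L) d
         (≤-trans (≤-reflexive (*-comm (length L) (suc s))) (≤-trans s*L≤d (m≤m+n d (e * d))))

lemma2p9 : (x : ℕ → ℕ) (α : ℕ → ℚ) (α₀ : ℚ) → 0ℚ ℚ.< α₀ → (∀ n → α₀ ℚ.< α n) →
    Folner (Fseq x α) → UpperDensityZero (Fseq x α) V
lemma2p9 x α α₀ 0<α₀ α₀<α folner = zeroDensity⇒upperDensityZero x α 0<α₀ α₀<α folner V-zeroDensity
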